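{- Let $p$ be a prime with $p\nmid d$, let $d>e\ge1$ be coprime integers, and let $t,\alpha$ be integers. For $n\ge0$: (1) $C_{t,n}=\sum_{i=0}^n(R_{i,\alpha}+r_{i,\alpha})-d\,\mathbf{C}_{t,n,\alpha}$. (2) $\mathbf{C}_{t,n+d,\alpha}=d-1+\mathbf{C}_{t,n,\alpha}$ and $C_{t,n+d}=C_{t,n}$. Consequently, in the setting below, $w(n+d)=1+w(n)$ for all $n\ge0$ and $P_{u,e,d}(dn)=H^\infty_{[0,d],u}(dn)$ for all $n\in\mathbb{N}$. (3) If $p>(d-e)(2d-1)$, then $w(n)\le w(n+1)$ for all $n\ge0$.
   Context: $\overline{x}$ denotes the least non-negative residue of an integer $x$ modulo $d$, and $e^{ -1}$ the inverse of $e$ modulo $d$. $S_n^*$ is the set of permutations of $I_n^*=\{0,1,\dots,n\}$. $C_{t,n}=\min_{\tau\in S_n^*}\sum_{i=0}^n\overline{e^{ -1}(pi-\tau(i)+t)}$ for $n\ge0$, and $C_{t,-1}=0$. $R_{i,\alpha}=\overline{e^{ -1}(pi+\alpha)}$, $r_{i,\alpha}=\overline{e^{ -1}(t-\alpha-i)}$, and $\mathbf{C}_{t,n,\alpha}=\max_{\tau\in S_n^*}\#\{i\in I_n^*: R_{i,\alpha}+r_{\tau(i),\alpha}\ge d\}$. For the statements about $w$, $P$, $H$: $a\ge1$, $q=p^a$, $0\le u\le q-2$ an integer, $b$ the least positive integer with $p^bu\equiv u\pmod{q-1}$, $u=\sum_{i=0}^{a-1}u_ip^i$ with $0\le u_i\le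 p-1$ and indices extended periodically. $P_{u,e,d}(n)=\frac{n(n-1)}{2d}+\frac{1}{bd(p-1)}\sum_{k=1}^b(nu_k+(d-e)C_{u_k,n-1})$ for $n\in\mathbb{N}$, and $w(n)=P_{u,e,d}(n+1)-P_{u,e,d}(n)$. $H^\infty_{[0,d],u}$ is the polygon from the origin whose successive slopes (each of horizontal length 1) are $\frac nd+\frac{1}{bd(p-1)}\sum_{k=1}^bu_k$, $n=0,1,2,\dots$. -}

module Defs where

open import Data.Nat as ℕ using (ℕ; zero; suc; _⊓_; _⊔_; _∸_; _≤ᵇ_)
open import Data.Integer as ℤ using (ℤ; +_)
open import Data.Integer.DivMod using (_%ℕ_)
open import Data.List using (List; []; _∷_; concatMap; map; zipWith; foldr; upTo; length)
open import Data.Nat.ListAction using (sum)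
open import Data.Bool using (Bool; true; false; if_then_else_)
open import Data.Rational as ℚ using (ℚ)
open import Data.Product using (_×_)
open import Relation.Binary.PropositionalEquality using (_≡_)
open import Relation.Nullary using (¬_)

-- least non-negative residue  x̄  of an integer x modulo d (d ≥ 1; value at d = 0 irrelevant)
res : ℕ → ℤ → ℕ
res zero    x = 0
res (suc m) x = x %ℕ suc m

insertAll : {A : Set} → A → List A → List (List A)
insertAll x []       = (x ∷ []) ∷ []
insertAll x (y ∷ ys) = (x ∷ y ∷ ys) ∷ map (y ∷_) (insertAll x ys)

perms : {A : Set} → List A → List (List A)
perms []       = [] ∷ []
perms (x ∷ xs) = concatMap (insertAll x) (perms xs)

-- a permutation τ of I_n^* = {0,…,n} is encoded as the list [τ(0), …, τ(n)];
-- SnStar n enumerates all of them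
SnStar : ℕ → List (List ℕ)
SnStar n = perms (upTo (suc n))

minList : List ℕ → ℕ
minList []       = 0
minList (x ∷ xs) = foldr _⊓_ x xs

maxList : List ℕ → ℕ
maxList = foldr _⊔_ 0

sumτ : (ℕ → ℕ → ℕ) → List ℕ → ℕ
sumτ f τ = sum (zipWith f (upTo (length τ)) τ)

Σ0to : ℕ → (ℕ → ℕ) → ℕ
Σ0to n f = sum (map f (upTo (suc n)))

-- Parameters: p, einv (= e^{-1} mod d, an integer), d.
-- C_{t,n} = min_τ Σ_i  \overline{e^{-1}(p i - τ(i) + t)}
C : (p : ℕ) (einv : ℤ) (d : ℕ) (t : ℤ) (n : ℕ) → ℕ
C p einv d t n = minList (map (sumτ λ i j → res d (einv ℤ.* ((+ p ℤ.* + i) ℤ.- + j ℤ.+ t))) (SnStar n))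

-- C_{t,n-1} with the convention C_{t,-1} = 0
Cpred : (p : ℕ) (einv : ℤ) (d : ℕ) (t : ℤ) (n : ℕ) → ℕ
Cpred p einv d t zero    = 0
Cpred p einv d t (suc n) = C p einv d t n

R : (p : ℕ) (einv : ℤ) (d : ℕ) (α : ℤ) (i : ℕ) → ℕ
R p einv d α i = res d (einv ℤ.* ((+ p ℤ.* + i) ℤ.+ α))

r : (einv : ℤ) (d : ℕ) (t α : ℤ) (i : ℕ) → ℕ
r einv d t α i = res d (einv ℤ.* (t ℤ.- α ℤ.- + i))

countTrue : List Bool → ℕ
countTrue bs = sum (map (λ b → if b then 1 else 0) bs)

Cbold : (p : ℕ) (einv : ℤ) (d : ℕ) (t : ℤ) (n : ℕ) (α : ℤ) → ℕ
Cbold p einv d t n α =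
  maxList (map (λ τ → countTrue (zipWith (λ i j → d ≤ᵇ (R p einv d α i ℕ.+ r einv d t α j))
                                          (upTo (length τ)) τ))
               (SnStar n))

ℚℕ : ℕ → ℚ
ℚℕ n = + n ℚ./ 1

-- 1/m as a rational (m ≥ 1 in all uses; value at 0 irrelevant)
recip : ℕ → ℚ
recip zero    = ℚ.0ℚ
recip (suc m) = + 1 ℚ./ suc m

-- ⌊n / m⌋ (m ≥ 1 in all uses; value at 0 irrelevant)
quot : ℕ → ℕ → ℕ
quot n zero    = 0
quot n (suc m) = n ℕ./ suc m

-- base-p digit u_k of u (u = Σ_{i<a} u_i p^i), indices extended periodically modulo a
digit : (p a u k : ℕ) → ℕ
digit p zero     u k = 0
digit p (suc a') u k = res p (+ quot u (p ℕ.^ (k ℕ.% suc a')))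

Σ1to : ℕ → (ℕ → ℕ) → ℕ
Σ1to b f = sum (map (λ k → f (suc k)) (upTo b))

P : (p a u b e d : ℕ) (einv : ℤ) (n : ℕ) → ℚ
P p a u b e d einv n =
  ℚℕ (n ℕ.* (n ∸ 1)) ℚ.* recip (2 ℕ.* d)
  ℚ.+ recip (b ℕ.* d ℕ.* (p ∸ 1))
      ℚ.* ℚℕ (Σ1to b λ k → n ℕ.* digit p a u k
                          ℕ.+ (d ∸ e) ℕ.* Cpred p einv d (+ digit p a u k) n)

w : (p a u b e d : ℕ) (einv : ℤ) (n : ℕ) → ℚ
w p a u b e d einv n = P p a u b e d einv (suc n) ℚ.- P p a u b e d einv n

-- H^∞_{[0,d],u} at integer abscissa x: sum of the first x slopes
--   n/d + 1/(b d (p-1)) Σ_{k=1}^b u_k ,  n = 0,…,x-1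
H : (p a u b d : ℕ) (x : ℕ) → ℚ
H p a u b d x = foldr ℚ._+_ ℚ.0ℚ (map (λ n → ℚℕ n ℚ.* recip d
                                  ℚ.+ recip (b ℕ.* d ℕ.* (p ∸ 1)) ℚ.* ℚℕ (Σ1to b (digit p a u)))
                           (upTo x))

IsLeastPeriod : (p a u b : ℕ) → Set
IsLeastPeriod p a u b =
  (1 ℕ.≤ b) ×
  (res (p ℕ.^ a ∸ 1) (+ (p ℕ.^ b ℕ.* u)) ≡ res (p ℕ.^ a ∸ 1) (+ u)) ×
  (∀ b′ → 1 ℕ.≤ b′ → b′ ℕ.< b →
     ¬ (res (p ℕ.^ a ∸ 1) (+ (p ℕ.^ b′ ℕ.* u)) ≡ res (p ℕ.^ a ∸ 1) (+ u)))

{-# OPTIONS --safe #-}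
-- Let g i j be the residue of e⁻¹(p i − j + t) mod d, so that C_{t,n} is the value of the
-- assignment problem for g on {0, …, n}. As g i j = R_i + r_j − d·[R_i + r_j ≥ d], the cost of
-- an assignment τ is Σ (R_i + r_i) minus d times the number of i with R_i + r_{τ i} ≥ d, so
-- minimising the one maximises the other: this is (1).
--
-- Because p and e⁻¹ are units mod d, the rows a, …, a + d − 1 can be matched at zero cost with
-- the columns a, …, a + d − 1, and g i j ≡ g i j₀ + g i₀ j − g i₀ j₀ (mod d) gives
-- g i j ≤ g i j₀ + g i₀ j whenever g i₀ j₀ = 0. Hence such a zero block can be added to or peeled
-- off an optimal assignment for free, and C is d-periodic; by (1) so is the bold C up to the
-- growth d(d − 1) of Σ (R_i + r_i) over d consecutive i.
--
-- P(n) is n(n − 1)/2d plus 1/(bd(p − 1)) times a sum that is linear in n up to the periodic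
-- terms (d − e)·C_{u_k,n−1}, which vanish at multiples of d. This gives w(n + d) = 1 + w(n)
-- and P = H at multiples of d. Finally, adding or deleting one row changes C by at most d − 1,
-- so the second difference of P is at least 1/d − 2(d − e)(d − 1)/(d(p − 1)), which is
-- non-negative when p > (d − e)(2d − 1).
module Submission where

open import Defs
open import Data.Nat as ℕ using (ℕ; zero; suc; _+_; _*_; _∸_; _^_; _≤_; _<_; _⊓_; _⊔_; _≤ᵇ_; z≤n; s≤s; nonTrivial⇒n>1)
import Data.Nat.Properties as NP
import Data.Nat.DivMod as ND
open import Data.Nat.Divisibility using (_∣_; m%n≡0⇒n∣m; n∣m⇒m%n≡0)
open import Data.Nat.Primality using (Prime; prime⇒irreducible; prime⇒nonTrivial)
open import Data.Nat.Coprimality using (Coprime; coprime-divisor)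
open import Data.Nat.ListAction using (sum)
import Data.Nat.ListAction.Properties as SP
import Data.Nat.Solver as ℕ-Solver
open import Data.Integer as ℤ using (ℤ; +_; ∣_∣)
import Data.Integer.Properties as ZP
open import Data.Integer.DivMod using (_/ℕ_; n%ℕd<d; a≡a%ℕn+[a/ℕn]*n)
import Data.Integer.Solver as ℤ-Solver
open import Data.Rational as ℚ using (ℚ; 0ℚ; 1ℚ; toℚᵘ)
import Data.Rational.Properties as QP
import Data.Rational.Unnormalised as ℚᵘ
import Data.Rational.Unnormalised.Properties as ℚᵘP
import Data.Rational.Solver as ℚ-Solver
open import Algebra.Properties.Group QP.+-0-group using () renaming (∙-cancelʳ to +-cancelʳ)
open import Data.Bool using (Bool; true; false; if_then_else_)
open import Data.List using (List; []; _∷_; _++_; [_]; _∷ʳ_; map; foldr; upTo; applyUpTo; length; zipWith)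
import Data.List.Properties as LP
open import Data.List.Membership.Propositional using (_∈_; _∉_; find; lose)
open import Data.List.Membership.Propositional.Properties using (∈-map⁺; ∈-map⁻; ∈-∃++; ∈-++⁻; ∈-concatMap⁺; ∈-concatMap⁻)
open import Data.List.Membership.DecPropositional ℕ._≟_ using (_∈?_)
open import Data.List.Relation.Unary.Any using (here; there)
open import Data.List.Relation.Unary.All as All using (All; []; _∷_)
import Data.List.Relation.Unary.All.Properties as AllP
open import Data.List.Relation.Unary.AllPairs using (_∷_)
open import Data.List.Relation.Unary.Unique.Propositional using (Unique)
import Data.List.Relation.Unary.Unique.Propositional.Properties as UniqueP
open import Data.List.Relation.Binary.Permutation.Propositional
  using (_↭_; ↭-refl; ↭-sym; ↭-trans; ↭-prep; ↭-swap; ↭-reflexive; ↭⇒↭ₛ; module PermutationReasoning)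
open import Data.List.Relation.Binary.Permutation.Propositional.Properties
  using (↭-empty-inv; ∈-resp-↭; All-resp-↭; drop-mid; shift; ∷↭∷ʳ; ↭-length; ++⁺; ++⁺ˡ; map⁺)
import Data.List.Relation.Binary.Permutation.Setoid.Properties as PermutationSetoid
open import Data.Product using (∃; ∃₂; _×_; _,_; proj₁)
open import Data.Sum using (inj₁; inj₂)
open import Data.Empty using (⊥-elim)
open import Function using (_∘_)
open import Relation.Nullary using (¬_; yes; no)
open import Relation.Nullary.Reflects using (ofʸ; ofⁿ)
open import Relation.Binary.PropositionalEquality
  using (_≡_; _≢_; refl; sym; trans; cong; cong₂; subst; setoid; module ≡-Reasoning)

module _ {A : Set} where

  ∈-insertAll⇒↭ : ∀ x zs {ys : List A} → ys ∈ insertAll x zs → ys ↭ x ∷ zs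
  ∈-insertAll⇒↭ x []       (here refl) = ↭-refl
  ∈-insertAll⇒↭ x (z ∷ zs) (here refl) = ↭-refl
  ∈-insertAll⇒↭ x (z ∷ zs) (there m) with ∈-map⁻ (z ∷_) m
  ... | ws , ws∈ , refl = ↭-trans (↭-prep z (∈-insertAll⇒↭ x zs ws∈)) (↭-swap z x ↭-refl)

  ∈-perms⇒↭ : ∀ xs {τ : List A} → τ ∈ perms xs → τ ↭ xs
  ∈-perms⇒↭ []       (here refl) = ↭-refl
  ∈-perms⇒↭ (x ∷ xs) m with find (∈-concatMap⁻ (insertAll x) {xs = perms xs} m)
  ... | zs , zs∈ , τ∈ = ↭-trans (∈-insertAll⇒↭ x zs τ∈) (↭-prep x (∈-perms⇒↭ xs zs∈))

  ++-∈-insertAll : ∀ x (ys zs : List A) → ys ++ x ∷ zs ∈ insertAll x (ys ++ zs)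
  ++-∈-insertAll x []       []       = here refl
  ++-∈-insertAll x []       (z ∷ zs) = here refl
  ++-∈-insertAll x (y ∷ ys) zs       = there (∈-map⁺ (y ∷_) (++-∈-insertAll x ys zs))

  ↭⇒∈-perms : ∀ xs {τ : List A} → τ ↭ xs → τ ∈ perms xs
  ↭⇒∈-perms []       τ↭[] with ↭-empty-inv τ↭[]
  ... | refl = here refl
  ↭⇒∈-perms (x ∷ xs) τ↭x∷xs with ∈-∃++ (∈-resp-↭ (↭-sym τ↭x∷xs) (here refl))
  ... | ys , zs , refl =
    ∈-concatMap⁺ (insertAll x) {xs = perms xs}
      (lose (↭⇒∈-perms xs (drop-mid ys [] τ↭x∷xs)) (++-∈-insertAll x ys zs))

  ∈-map-perms : ∀ {B : Set} (f : List A → B) xs {y} → y ∈ map f (perms xs) → ∃ λ τ → τ ↭ xs × y ≡ f τ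
  ∈-map-perms f xs y∈ with ∈-map⁻ f y∈
  ... | τ , τ∈ , y≡fτ = τ , ∈-perms⇒↭ xs τ∈ , y≡fτ

foldr-⊓-≤ : ∀ x xs {y} → y ∈ x ∷ xs → foldr _⊓_ x xs ≤ y
foldr-⊓-≤ x []       (here refl)         = NP.≤-refl
foldr-⊓-≤ x (z ∷ xs) (here refl)         = NP.≤-trans (NP.m⊓n≤n z _) (foldr-⊓-≤ x xs (here refl))
foldr-⊓-≤ x (z ∷ xs) (there (here refl)) = NP.m⊓n≤m z _
foldr-⊓-≤ x (z ∷ xs) (there (there m))   = NP.≤-trans (NP.m⊓n≤n z _) (foldr-⊓-≤ x xs (there m))

foldr-⊓-∈ : ∀ x xs → foldr _⊓_ x xs ∈ x ∷ xs
foldr-⊓-∈ x []       = here refl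
foldr-⊓-∈ x (z ∷ xs) with NP.⊓-sel z (foldr _⊓_ x xs) | foldr-⊓-∈ x xs
... | inj₁ eq | _       = subst (_∈ x ∷ z ∷ xs) (sym eq) (there (here refl))
... | inj₂ eq | here e  = subst (_∈ x ∷ z ∷ xs) (sym (trans eq e)) (here refl)
... | inj₂ eq | there m = subst (_∈ x ∷ z ∷ xs) (sym eq) (there (there m))

minList-≤ : ∀ {xs y} → y ∈ xs → minList xs ≤ y
minList-≤ {x ∷ xs} = foldr-⊓-≤ x xs

minList-∈ : ∀ {xs y} → y ∈ xs → minList xs ∈ xs
minList-∈ {x ∷ xs} _ = foldr-⊓-∈ x xs

maxList-≥ : ∀ {xs y} → y ∈ xs → y ≤ maxList xs
maxList-≥ {x ∷ xs} (here refl) = NP.m≤m⊔n x (maxList xs)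
maxList-≥ {x ∷ xs} (there m)   = NP.≤-trans (maxList-≥ m) (NP.m≤n⊔m x (maxList xs))

maxList-∷-∈ : ∀ x xs → maxList (x ∷ xs) ∈ x ∷ xs
maxList-∷-∈ x []       = subst (_∈ x ∷ []) (sym (NP.⊔-identityʳ x)) (here refl)
maxList-∷-∈ x (z ∷ xs) with NP.⊔-sel x (maxList (z ∷ xs))
... | inj₁ eq = subst (_∈ x ∷ z ∷ xs) (sym eq) (here refl)
... | inj₂ eq = subst (_∈ x ∷ z ∷ xs) (sym eq) (there (maxList-∷-∈ z xs))

maxList-∈ : ∀ {xs y} → y ∈ xs → maxList xs ∈ xs
maxList-∈ {x ∷ xs} _ = maxList-∷-∈ x xs

module _ (f : List ℕ → ℕ) (xs : List ℕ) where

  private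
    fxs∈ : f xs ∈ map f (perms xs)
    fxs∈ = ∈-map⁺ f (↭⇒∈-perms xs ↭-refl)

  minList-perms-≤ : ∀ {τ} → τ ↭ xs → minList (map f (perms xs)) ≤ f τ
  minList-perms-≤ τ↭xs = minList-≤ (∈-map⁺ f (↭⇒∈-perms xs τ↭xs))

  minList-perms-attained : ∃ λ τ → τ ↭ xs × minList (map f (perms xs)) ≡ f τ
  minList-perms-attained = ∈-map-perms f xs (minList-∈ fxs∈)

  maxList-perms-≥ : ∀ {τ} → τ ↭ xs → f τ ≤ maxList (map f (perms xs))
  maxList-perms-≥ τ↭xs = maxList-≥ (∈-map⁺ f (↭⇒∈-perms xs τ↭xs))

  maxList-perms-attained : ∃ λ τ → τ ↭ xs × maxList (map f (perms xs)) ≡ f τ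
  maxList-perms-attained = ∈-map-perms f xs (maxList-∈ fxs∈)

upTo-+ : ∀ a m → upTo (a + m) ≡ upTo a ++ applyUpTo (a ℕ.+_) m
upTo-+ a zero    = trans (cong upTo (NP.+-identityʳ a)) (sym (LP.++-identityʳ (upTo a)))
upTo-+ a (suc m) = begin
  upTo (a + suc m)                              ≡⟨ cong upTo (NP.+-suc a m) ⟩
  upTo (suc (a + m))                            ≡⟨ LP.upTo-∷ʳ (a + m) ⟨
  upTo (a + m) ∷ʳ (a + m)                       ≡⟨ cong (_∷ʳ (a + m)) (upTo-+ a m) ⟩
  (upTo a ++ applyUpTo (a ℕ.+_) m) ∷ʳ (a + m)   ≡⟨ LP.++-assoc (upTo a) _ _ ⟩
  upTo a ++ (applyUpTo (a ℕ.+_) m ∷ʳ (a + m))   ≡⟨ cong (upTo a ++_) (LP.applyUpTo-∷ʳ (a ℕ.+_) m) ⟩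
  upTo a ++ applyUpTo (a ℕ.+_) (suc m)          ∎
  where open ≡-Reasoning

unique-resp-↭ : ∀ {xs ys : List ℕ} → xs ↭ ys → Unique xs → Unique ys
unique-resp-↭ xs↭ys = PermutationSetoid.Unique-resp-↭ (setoid ℕ) (↭⇒↭ₛ xs↭ys)

All-<-pred : ∀ {k xs} → All (_< suc k) xs → k ∉ xs → All (_< k) xs
All-<-pred []         k∉ = []
All-<-pred (x<1+k ∷ a) k∉ =
  NP.≤∧≢⇒< (NP.≤-pred x<1+k) (λ x≡k → k∉ (here (sym x≡k))) ∷ All-<-pred a (λ k∈ → k∉ (there k∈))

extract-max : ∀ {k xs} → Unique xs → All (_< suc k) xs → k ∈ xs →
              ∃ λ ys → xs ↭ k ∷ ys × Unique ys × All (_< k) ys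
extract-max {k} uniq bound k∈ with ∈-∃++ k∈
... | ys , zs , refl with unique-resp-↭ (shift k ys zs) uniq
... | k∉ ∷ uniq′ = ys ++ zs , shift k ys zs , uniq′ ,
  All-<-pred (All.tail (All-resp-↭ (shift k ys zs) bound))
             (λ k∈′ → All.lookup k∉ k∈′ refl)

unique-bounded-length≤ : ∀ k {xs} → Unique xs → All (_< k) xs → length xs ≤ k
unique-bounded-length≤ zero    {[]}    _    _      = z≤n
unique-bounded-length≤ zero    {_ ∷ _} _    (() ∷ _)
unique-bounded-length≤ (suc k) {xs}    uniq bound with k ∈? xs
... | no k∉  = NP.m≤n⇒m≤1+n (unique-bounded-length≤ k uniq (All-<-pred bound k∉))
... | yes k∈ with extract-max uniq bound k∈
... | ys , xs↭ , uniq′ , bound′ =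
  subst (_≤ suc k) (sym (↭-length xs↭)) (s≤s (unique-bounded-length≤ k uniq′ bound′))

unique-bounded-↭-upTo : ∀ m {xs} → Unique xs → All (_< m) xs → length xs ≡ m → xs ↭ upTo m
unique-bounded-↭-upTo zero    {[]} _    _     _   = ↭-refl
unique-bounded-↭-upTo (suc m) {xs} uniq bound len with m ∈? xs
... | no m∉  = ⊥-elim (NP.<-irrefl len
                 (s≤s (unique-bounded-length≤ m uniq (All-<-pred bound m∉))))
... | yes m∈ with extract-max uniq bound m∈
... | ys , xs↭ , uniq′ , bound′ = begin
  xs             ↭⟨ xs↭ ⟩
  m ∷ ys         ↭⟨ ↭-prep m (unique-bounded-↭-upTo m uniq′ bound′ len′) ⟩
  m ∷ upTo m     ↭⟨ ∷↭∷ʳ m (upTo m) ⟩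
  upTo m ∷ʳ m    ≡⟨ LP.upTo-∷ʳ m ⟩
  upTo (suc m)   ∎
  where
  open PermutationReasoning
  len′ : length ys ≡ m
  len′ = NP.suc-injective (trans (sym (↭-length xs↭)) len)

length-↭-upTo : ∀ {a} {τ : List ℕ} → τ ↭ upTo a → length τ ≡ a
length-↭-upTo {a} τ↭ = trans (↭-length τ↭) (LP.length-upTo a)

module _ {A : Set} where

  unsnoc : ∀ (τ : List A) n → length τ ≡ suc n →
           ∃₂ λ τ′ j → τ ≡ τ′ ∷ʳ j × length τ′ ≡ n
  unsnoc (j ∷ [])     zero    refl = [] , j , refl , refl
  unsnoc (j ∷ k ∷ τ)  (suc n) len with unsnoc (k ∷ τ) n (NP.suc-injective len)
  ... | τ′ , l , eq , len′ = j ∷ τ′ , l , cong (j ∷_) eq , cong suc len′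

  split-like : ∀ {B : Set} (is : List B) (τ₁ τ₂ : List A) j → length is ≡ length (τ₁ ++ j ∷ τ₂) →
    ∃₂ λ is₁ i → ∃ λ is₂ → is ≡ is₁ ++ i ∷ is₂ × length is₁ ≡ length τ₁
  split-like []       τ₁       τ₂ j len =
    ⊥-elim (NP.0≢1+n (trans len (trans (LP.length-++ τ₁) (NP.+-suc (length τ₁) (length τ₂)))))
  split-like (i ∷ is) []       τ₂ j len = [] , i , is , refl , refl
  split-like (i ∷ is) (_ ∷ τ₁) τ₂ j len with split-like is τ₁ τ₂ j (NP.suc-injective len)
  ... | is₁ , i₁ , is₂ , refl , len₁ = i ∷ is₁ , i₁ , is₂ , refl , cong suc len₁

<⇒≤∸1 : ∀ {m n} → m < n → m ≤ n ∸ 1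
<⇒≤∸1 {n = suc n} (s≤s m≤n) = m≤n

m+n≡s⇒m≡s-n : ∀ {m n s} → m + n ≡ s → + m ≡ + s ℤ.- + n
m+n≡s⇒m≡s-n {m} {n} refl =
  sym (trans (ZP.m-n≡m⊖n (m + n) n) (trans (ZP.⊖-≥ (NP.m≤n+m n m)) (cong +_ (NP.m+n∸n≡m m n))))

m[m∸1]+2m : ∀ m → m * (m ∸ 1) + 2 * m ≡ suc m * m
m[m∸1]+2m zero    = refl
m[m∸1]+2m (suc m) =
  solve 1 (λ m → (con 1 :+ m) :* m :+ con 2 :* (con 1 :+ m) := (con 2 :+ m) :* (con 1 :+ m)) refl m
  where open ℕ-Solver.+-*-Solver

sum-map-+ : ∀ (f h : ℕ → ℕ) xs → sum (map (λ i → f i + h i) xs) ≡ sum (map f xs) + sum (map h xs)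
sum-map-+ f h []       = refl
sum-map-+ f h (x ∷ xs) = trans (cong (f x + h x ℕ.+_) (sum-map-+ f h xs))
  (solve 4 (λ a b c d → a :+ b :+ (c :+ d) := a :+ c :+ (b :+ d))
         refl (f x) (h x) (sum (map f xs)) (sum (map h xs)))
  where open ℕ-Solver.+-*-Solver

sum-upTo-suc : ∀ n → sum (upTo (suc n)) ≡ sum (upTo n) + n
sum-upTo-suc n = trans (cong sum (sym (LP.upTo-∷ʳ n)))
  (trans (SP.sum-++ (upTo n) [ n ]) (cong (sum (upTo n) ℕ.+_) (NP.+-identityʳ n)))

sum-upTo-double : ∀ n → sum (upTo n) + sum (upTo n) ≡ n * (n ∸ 1)
sum-upTo-double zero    = refl
sum-upTo-double (suc n) = begin
  sum (upTo (suc n)) + sum (upTo (suc n)) ≡⟨ cong₂ _+_ (sum-upTo-suc n) (sum-upTo-suc n) ⟩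
  (sum (upTo n) + n) + (sum (upTo n) + n) ≡⟨ solve 2 (λ s n → (s :+ n) :+ (s :+ n) := (s :+ s) :+ con 2 :* n) refl (sum (upTo n)) n ⟩
  (sum (upTo n) + sum (upTo n)) + 2 * n   ≡⟨ cong (_+ 2 * n) (sum-upTo-double n) ⟩
  n * (n ∸ 1) + 2 * n                     ≡⟨ m[m∸1]+2m n ⟩
  suc n * n                               ∎
  where
  open ≡-Reasoning
  open ℕ-Solver.+-*-Solver

sum-map-* : ∀ c (f : ℕ → ℕ) xs → sum (map (λ k → c * f k) xs) ≡ c * sum (map f xs)
sum-map-* c f []       = sym (NP.*-zeroʳ c)
sum-map-* c f (x ∷ xs) = trans (cong (c * f x ℕ.+_) (sum-map-* c f xs)) (sym (NP.*-distribˡ-+ c (f x) _))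

sum-map-mono : ∀ (f h : ℕ → ℕ) xs → (∀ k → f k ≤ h k) → sum (map f xs) ≤ sum (map h xs)
sum-map-mono f h []       _   = z≤n
sum-map-mono f h (x ∷ xs) f≤h = NP.+-mono-≤ (f≤h x) (sum-map-mono f h xs f≤h)

sum-map-const : ∀ c (xs : List ℕ) → sum (map (λ _ → c) xs) ≡ length xs * c
sum-map-const c []       = refl
sum-map-const c (x ∷ xs) = cong (c ℕ.+_) (sum-map-const c xs)

module _ (b : ℕ) where

  Σ1to-+ : ∀ (f h : ℕ → ℕ) → Σ1to b (λ k → f k + h k) ≡ Σ1to b f + Σ1to b h
  Σ1to-+ f h = sum-map-+ (f ∘ suc) (h ∘ suc) (upTo b)

  Σ1to-* : ∀ c (f : ℕ → ℕ) → Σ1to b (λ k → c * f k) ≡ c * Σ1to b f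
  Σ1to-* c f = sum-map-* c (f ∘ suc) (upTo b)

  Σ1to-mono : ∀ (f h : ℕ → ℕ) → (∀ k → f k ≤ h k) → Σ1to b f ≤ Σ1to b h
  Σ1to-mono f h f≤h = sum-map-mono (f ∘ suc) (h ∘ suc) (upTo b) (f≤h ∘ suc)

  Σ1to-const : ∀ c → Σ1to b (λ _ → c) ≡ b * c
  Σ1to-const c = trans (sum-map-const c (upTo b)) (cong (_* c) (LP.length-upTo b))

  Σ1to-cong : ∀ {f h : ℕ → ℕ} → (∀ k → f k ≡ h k) → Σ1to b f ≡ Σ1to b h
  Σ1to-cong f≡h = cong sum (LP.map-cong (f≡h ∘ suc) (upTo b))

-- Residues modulo d

module Residues (dm : ℕ) where

  D : ℕ
  D = suc dm

  res-< : ∀ x → res D x < D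
  res-< x = n%ℕd<d x D

  res-decomposition : ∀ x → x ≡ + res D x ℤ.+ (x /ℕ D) ℤ.* + D
  res-decomposition x = a≡a%ℕn+[a/ℕn]*n x D

  private
    multiple-<D : ∀ a {m} → m < D → m ≡ a ℕ.* D → a ≡ 0
    multiple-<D zero    _   _   = refl
    multiple-<D (suc a) m<D refl = ⊥-elim (NP.<-irrefl refl (NP.<-≤-trans m<D (NP.m≤m+n D (a ℕ.* D))))

    ≡-mod-≤ : ∀ {k k′} q q′ → k < D → k′ ≤ k →
              + k ℤ.+ q ℤ.* + D ≡ + k′ ℤ.+ q′ ℤ.* + D → k ≡ k′
    ≡-mod-≤ {k} {k′} q q′ k<D k′≤k eq = NP.≤-antisym (NP.m∸n≡0⇒m≤n k∸k′≡0) k′≤k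
      where
      open ≡-Reasoning
      open ℤ-Solver.+-*-Solver
      k∸k′≡ : + (k ℕ.∸ k′) ≡ (q′ ℤ.- q) ℤ.* + D
      k∸k′≡ = begin
        + (k ℕ.∸ k′)
          ≡⟨ trans (ZP.m-n≡m⊖n k k′) (ZP.⊖-≥ k′≤k) ⟨
        + k ℤ.- + k′
          ≡⟨ solve 4 (λ a b x y → a :- b := (a :+ x :* y) :- (b :+ x :* y)) refl (+ k) (+ k′) q (+ D) ⟩
        (+ k ℤ.+ q ℤ.* + D) ℤ.- (+ k′ ℤ.+ q ℤ.* + D)
          ≡⟨ cong (ℤ._- (+ k′ ℤ.+ q ℤ.* + D)) eq ⟩
        (+ k′ ℤ.+ q′ ℤ.* + D) ℤ.- (+ k′ ℤ.+ q ℤ.* + D)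
          ≡⟨ solve 4 (λ b x z y → (b :+ z :* y) :- (b :+ x :* y) := (z :- x) :* y) refl (+ k′) q q′ (+ D) ⟩
        (q′ ℤ.- q) ℤ.* + D ∎
      k∸k′≡∣q′-q∣D : k ℕ.∸ k′ ≡ ∣ q′ ℤ.- q ∣ ℕ.* D
      k∸k′≡∣q′-q∣D = trans (cong ∣_∣ k∸k′≡) (ZP.∣i*j∣≡∣i∣*∣j∣ (q′ ℤ.- q) (+ D))
      k∸k′≡0 : k ℕ.∸ k′ ≡ 0
      k∸k′≡0 = trans k∸k′≡∣q′-q∣D (cong (ℕ._* D)
        (multiple-<D ∣ q′ ℤ.- q ∣ (NP.≤-<-trans (NP.m∸n≤m k k′) k<D) k∸k′≡∣q′-q∣D))

  ≡-mod⇒≡ : ∀ {k k′} q q′ → k < D → k′ < D →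
            + k ℤ.+ q ℤ.* + D ≡ + k′ ℤ.+ q′ ℤ.* + D → k ≡ k′
  ≡-mod⇒≡ {k} {k′} q q′ k<D k′<D eq with NP.≤-total k′ k
  ... | inj₁ k′≤k = ≡-mod-≤ q q′ k<D k′≤k eq
  ... | inj₂ k≤k′ = sym (≡-mod-≤ q′ q k′<D k≤k′ (sym eq))

  res-+-multiple-of-< : ∀ {k} q → k < D → res D (+ k ℤ.+ q ℤ.* + D) ≡ k
  res-+-multiple-of-< {k} q k<D =
    ≡-mod⇒≡ (y /ℕ D) q (res-< y) k<D (sym (res-decomposition y))
    where y = + k ℤ.+ q ℤ.* + D

  res-+-multiple : ∀ x q → res D (x ℤ.+ q ℤ.* + D) ≡ res D x
  res-+-multiple x q = trans (cong (res D) x+qD≡) (res-+-multiple-of-< ((x /ℕ D) ℤ.+ q) (res-< x))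
    where
    open ≡-Reasoning
    open ℤ-Solver.+-*-Solver
    x+qD≡ : x ℤ.+ q ℤ.* + D ≡ + res D x ℤ.+ ((x /ℕ D) ℤ.+ q) ℤ.* + D
    x+qD≡ = begin
      x ℤ.+ q ℤ.* + D
        ≡⟨ cong (ℤ._+ q ℤ.* + D) (res-decomposition x) ⟩
      + res D x ℤ.+ (x /ℕ D) ℤ.* + D ℤ.+ q ℤ.* + D
        ≡⟨ solve 4 (λ r a q d → r :+ a :* d :+ q :* d := r :+ (a :+ q) :* d) refl (+ res D x) (x /ℕ D) q (+ D) ⟩
      + res D x ℤ.+ ((x /ℕ D) ℤ.+ q) ℤ.* + D ∎

  res-multiple : ∀ q → res D (q ℤ.* + D) ≡ 0
  res-multiple q = trans (cong (res D) (sym (ZP.+-identityˡ (q ℤ.* + D)))) (res-+-multiple-of-< q (s≤s z≤n))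

  res≡0⇒multiple : ∀ x → res D x ≡ 0 → x ≡ (x /ℕ D) ℤ.* + D
  res≡0⇒multiple x r≡0 =
    trans (res-decomposition x) (trans (cong (λ z → + z ℤ.+ (x /ℕ D) ℤ.* + D) r≡0) (ZP.+-identityˡ _))

  private
    sum-decomposition : ∀ x y → x ℤ.+ y ≡ + (res D x ℕ.+ res D y) ℤ.+ ((x /ℕ D) ℤ.+ (y /ℕ D)) ℤ.* + D
    sum-decomposition x y = begin
      x ℤ.+ y
        ≡⟨ cong₂ ℤ._+_ (res-decomposition x) (res-decomposition y) ⟩
      (+ res D x ℤ.+ (x /ℕ D) ℤ.* + D) ℤ.+ (+ res D y ℤ.+ (y /ℕ D) ℤ.* + D)
        ≡⟨ solve 5 (λ r a s b d → (r :+ a :* d) :+ (s :+ b :* d) := (r :+ s) :+ (a :+ b) :* d)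
                 refl (+ res D x) (x /ℕ D) (+ res D y) (y /ℕ D) (+ D) ⟩
      (+ res D x ℤ.+ + res D y) ℤ.+ ((x /ℕ D) ℤ.+ (y /ℕ D)) ℤ.* + D
        ≡⟨ cong (ℤ._+ ((x /ℕ D) ℤ.+ (y /ℕ D)) ℤ.* + D) (ZP.pos-+ (res D x) (res D y)) ⟨
      + (res D x ℕ.+ res D y) ℤ.+ ((x /ℕ D) ℤ.+ (y /ℕ D)) ℤ.* + D ∎
      where
      open ≡-Reasoning
      open ℤ-Solver.+-*-Solver

  res-+-< : ∀ x y → res D x ℕ.+ res D y < D → res D (x ℤ.+ y) ≡ res D x ℕ.+ res D y
  res-+-< x y lt = trans (cong (res D) (sum-decomposition x y)) (res-+-multiple-of-< ((x /ℕ D) ℤ.+ (y /ℕ D)) lt)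

  res-+-≥ : ∀ x y → D ≤ res D x ℕ.+ res D y → res D (x ℤ.+ y) ℕ.+ D ≡ res D x ℕ.+ res D y
  res-+-≥ x y ge = begin
    res D (x ℤ.+ y) ℕ.+ D
      ≡⟨ cong (λ z → res D z ℕ.+ D) (sum-decomposition x y) ⟩
    res D (+ (res D x ℕ.+ res D y) ℤ.+ Q ℤ.* + D) ℕ.+ D
      ≡⟨ cong (λ z → res D (+ z ℤ.+ Q ℤ.* + D) ℕ.+ D) (NP.m∸n+n≡m ge) ⟨
    res D (+ (s ℕ.+ D) ℤ.+ Q ℤ.* + D) ℕ.+ D
      ≡⟨ cong (λ z → res D (z ℤ.+ Q ℤ.* + D) ℕ.+ D) (ZP.pos-+ s D) ⟩
    res D ((+ s ℤ.+ + D) ℤ.+ Q ℤ.* + D) ℕ.+ D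
      ≡⟨ cong (λ z → res D z ℕ.+ D) (solve 3 (λ s d q → (s :+ d) :+ q :* d := s :+ (q :+ con (+ 1)) :* d)
                                           refl (+ s) (+ D) Q) ⟩
    res D (+ s ℤ.+ (Q ℤ.+ + 1) ℤ.* + D) ℕ.+ D
      ≡⟨ cong (ℕ._+ D) (res-+-multiple-of-< (Q ℤ.+ + 1) s<D) ⟩
    s ℕ.+ D
      ≡⟨ NP.m∸n+n≡m ge ⟩
    res D x ℕ.+ res D y ∎
    where
    open ≡-Reasoning
    open ℤ-Solver.+-*-Solver
    s = res D x ℕ.+ res D y ℕ.∸ D
    Q = (x /ℕ D) ℤ.+ (y /ℕ D)
    s<D : s < D
    s<D = NP.+-cancelʳ-< D s D (subst (ℕ._< D ℕ.+ D) (sym (NP.m∸n+n≡m ge)) (NP.+-mono-< (res-< x) (res-< y)))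

  res-+-≤ : ∀ x y → res D (x ℤ.+ y) ≤ res D x ℕ.+ res D y
  res-+-≤ x y with res D x ℕ.+ res D y ℕ.<? D
  ... | yes lt = NP.≤-reflexive (res-+-< x y lt)
  ... | no ¬lt = NP.≤-trans (NP.m≤m+n _ D) (NP.≤-reflexive (res-+-≥ x y (NP.≮⇒≥ ¬lt)))

  Cancellable : ℤ → Set
  Cancellable c = ∀ x → res D (c ℤ.* x) ≡ 0 → res D x ≡ 0

  cancellable-* : ∀ a b → Cancellable a → Cancellable b → Cancellable (a ℤ.* b)
  cancellable-* a b ca cb x abx≡0 = cb x (ca (b ℤ.* x) (trans (cong (res D) (sym (ZP.*-assoc a b x))) abx≡0))

  cancellable-neg : ∀ a → Cancellable a → Cancellable (ℤ.- a)
  cancellable-neg a ca x -ax≡0 = trans (cong (res D) x≡) (res-multiple (ℤ.- q))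
    where
    q = (ℤ.- x) /ℕ D
    -x≡ : ℤ.- x ≡ q ℤ.* + D
    -x≡ = res≡0⇒multiple (ℤ.- x)
      (ca (ℤ.- x) (trans (cong (res D) (trans (sym (ZP.neg-distribʳ-* a x)) (ZP.neg-distribˡ-* a x))) -ax≡0))
    x≡ : x ≡ ℤ.- q ℤ.* + D
    x≡ = trans (sym (ZP.neg-involutive x)) (trans (cong ℤ.-_ -x≡) (ZP.neg-distribˡ-* q (+ D)))

  cancellable-inverse : ∀ e c → res D (e ℤ.* c) ≡ 1 → Cancellable c
  cancellable-inverse e c ec≡1 x cx≡0 = trans (cong (res D) x≡) (res-multiple (e ℤ.* q′ ℤ.- q ℤ.* x))
    where
    open ≡-Reasoning
    open ℤ-Solver.+-*-Solver
    q  = (e ℤ.* c) /ℕ D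
    q′ = (c ℤ.* x) /ℕ D
    ec≡ : e ℤ.* c ≡ + 1 ℤ.+ q ℤ.* + D
    ec≡ = trans (res-decomposition (e ℤ.* c)) (cong (λ z → + z ℤ.+ q ℤ.* + D) ec≡1)
    x≡ : x ≡ (e ℤ.* q′ ℤ.- q ℤ.* x) ℤ.* + D
    x≡ = begin
      x
        ≡⟨ solve 3 (λ x q d → x := (con (+ 1) :+ q :* d) :* x :- q :* d :* x) refl x q (+ D) ⟩
      (+ 1 ℤ.+ q ℤ.* + D) ℤ.* x ℤ.- q ℤ.* + D ℤ.* x
        ≡⟨ cong (λ z → z ℤ.* x ℤ.- q ℤ.* + D ℤ.* x) ec≡ ⟨
      e ℤ.* c ℤ.* x ℤ.- q ℤ.* + D ℤ.* x
        ≡⟨ cong (λ z → z ℤ.- q ℤ.* + D ℤ.* x) (ZP.*-assoc e c x) ⟩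
      e ℤ.* (c ℤ.* x) ℤ.- q ℤ.* + D ℤ.* x
        ≡⟨ cong (λ z → e ℤ.* z ℤ.- q ℤ.* + D ℤ.* x) (res≡0⇒multiple (c ℤ.* x) cx≡0) ⟩
      e ℤ.* (q′ ℤ.* + D) ℤ.- q ℤ.* + D ℤ.* x
        ≡⟨ solve 5 (λ e a q x d → e :* (a :* d) :- q :* d :* x := (e :* a :- q :* x) :* d) refl e q′ q x (+ D) ⟩
      (e ℤ.* q′ ℤ.- q ℤ.* x) ℤ.* + D ∎

  prime-cancellable : ∀ {p} → Prime p → ¬ (p ∣ D) → Cancellable (+ p)
  prime-cancellable {p} p-prime p∤D x px≡0 = trans (sym (ND.m<n⇒m%n≡m (res-< x))) (n∣m⇒m%n≡0 (res D x) D D∣x̄)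
    where
    open ≡-Reasoning
    open ℤ-Solver.+-*-Solver
    x̄ = res D x
    q = x /ℕ D
    px≡ : + p ℤ.* x ≡ + (p ℕ.* x̄) ℤ.+ (+ p ℤ.* q) ℤ.* + D
    px≡ = begin
      + p ℤ.* x
        ≡⟨ cong (+ p ℤ.*_) (res-decomposition x) ⟩
      + p ℤ.* (+ x̄ ℤ.+ q ℤ.* + D)
        ≡⟨ solve 4 (λ p r q d → p :* (r :+ q :* d) := p :* r :+ (p :* q) :* d) refl (+ p) (+ x̄) q (+ D) ⟩
      + p ℤ.* + x̄ ℤ.+ (+ p ℤ.* q) ℤ.* + D
        ≡⟨ cong (ℤ._+ (+ p ℤ.* q) ℤ.* + D) (ZP.pos-* p x̄) ⟨
      + (p ℕ.* x̄) ℤ.+ (+ p ℤ.* q) ℤ.* + D ∎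
    px̄%D≡0 : (p ℕ.* x̄) ND.% D ≡ 0
    px̄%D≡0 = trans (sym (res-+-multiple (+ (p ℕ.* x̄)) (+ p ℤ.* q))) (trans (cong (res D) (sym px≡)) px≡0)
    coprime : Coprime D p
    coprime (i∣D , i∣p) with prime⇒irreducible p-prime i∣p
    ... | inj₁ i≡1 = i≡1
    ... | inj₂ refl = ⊥-elim (p∤D i∣D)
    D∣x̄ : D ∣ x̄
    D∣x̄ = coprime-divisor coprime (m%n≡0⇒n∣m (p ℕ.* x̄) D px̄%D≡0)

  res-affine-injective : ∀ c → Cancellable c → ∀ β {k k′} →
    res D (c ℤ.* + k ℤ.+ β) ≡ res D (c ℤ.* + k′ ℤ.+ β) → k′ ≤ k → k < k′ ℕ.+ D → k ≡ k′
  res-affine-injective c cc β {k} {k′} eq k′≤k k<k′+D = NP.≤-antisym (NP.m∸n≡0⇒m≤n δ≡0) k′≤k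
    where
    open ≡-Reasoning
    open ℤ-Solver.+-*-Solver
    A = c ℤ.* + k ℤ.+ β
    B = c ℤ.* + k′ ℤ.+ β
    cδ≡ : c ℤ.* + (k ℕ.∸ k′) ≡ ((A /ℕ D) ℤ.- (B /ℕ D)) ℤ.* + D
    cδ≡ = begin
      c ℤ.* + (k ℕ.∸ k′)
        ≡⟨ cong (c ℤ.*_) (trans (ZP.m-n≡m⊖n k k′) (ZP.⊖-≥ k′≤k)) ⟨
      c ℤ.* (+ k ℤ.- + k′)
        ≡⟨ solve 4 (λ c k l b → c :* (k :- l) := (c :* k :+ b) :- (c :* l :+ b)) refl c (+ k) (+ k′) β ⟩
      A ℤ.- B
        ≡⟨ cong₂ ℤ._-_ (res-decomposition A) (res-decomposition B) ⟩
      (+ res D A ℤ.+ (A /ℕ D) ℤ.* + D) ℤ.- (+ res D B ℤ.+ (B /ℕ D) ℤ.* + D)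
        ≡⟨ cong (λ z → (+ res D A ℤ.+ (A /ℕ D) ℤ.* + D) ℤ.- (+ z ℤ.+ (B /ℕ D) ℤ.* + D)) eq ⟨
      (+ res D A ℤ.+ (A /ℕ D) ℤ.* + D) ℤ.- (+ res D A ℤ.+ (B /ℕ D) ℤ.* + D)
        ≡⟨ solve 4 (λ r a b d → (r :+ a :* d) :- (r :+ b :* d) := (a :- b) :* d)
                 refl (+ res D A) (A /ℕ D) (B /ℕ D) (+ D) ⟩
      ((A /ℕ D) ℤ.- (B /ℕ D)) ℤ.* + D ∎
    δ<D : k ℕ.∸ k′ < D
    δ<D = NP.+-cancelˡ-< k′ (k ℕ.∸ k′) D (subst (ℕ._< k′ ℕ.+ D) (sym (NP.m+[n∸m]≡n k′≤k)) k<k′+D)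
    δ≡0 : k ℕ.∸ k′ ≡ 0
    δ≡0 = trans (sym (ND.m<n⇒m%n≡m δ<D))
                (cc (+ (k ℕ.∸ k′)) (trans (cong (res D) cδ≡) (res-multiple ((A /ℕ D) ℤ.- (B /ℕ D)))))

  res-affine-window-↭ : ∀ c → Cancellable c → ∀ β a →
    map (λ k → res D (c ℤ.* + k ℤ.+ β)) (applyUpTo (a ℕ.+_) D) ↭ upTo D
  res-affine-window-↭ c cc β a = unique-bounded-↭-upTo D unique bounded length≡D
    where
    h = λ k → res D (c ℤ.* + k ℤ.+ β)
    window = map h (applyUpTo (a ℕ.+_) D)
    window≡ : window ≡ applyUpTo (h ∘ (a ℕ.+_)) D
    window≡ = LP.map-applyUpTo (a ℕ.+_) h D
    distinct : ∀ {i j} → i < j → j < D → h (a ℕ.+ i) ≢ h (a ℕ.+ j)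
    distinct {i} {j} i<j j<D eq = NP.<⇒≢ i<j (NP.+-cancelˡ-≡ a i j (sym
      (res-affine-injective c cc β (sym eq) (NP.+-monoʳ-≤ a (NP.<⇒≤ i<j))
        (subst (a ℕ.+ j <_) (sym (NP.+-assoc a i D)) (NP.+-monoʳ-< a (NP.≤-trans j<D (NP.m≤n+m D i)))))))
    unique : Unique window
    unique = subst Unique (sym window≡) (UniqueP.applyUpTo⁺₁ (h ∘ (a ℕ.+_)) D distinct)
    bounded : All (_< D) window
    bounded = AllP.map⁺ (All.universal (λ k → res-< (c ℤ.* + k ℤ.+ β)) _)
    length≡D : length window ≡ D
    length≡D = trans (LP.length-map h (applyUpTo (a ℕ.+_) D)) (LP.length-applyUpTo (a ℕ.+_) D)

-- The assignment problem

module Assignment (g : ℕ → ℕ → ℕ) where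

  cost : List ℕ → List ℕ → ℕ
  cost is τ = sum (zipWith g is τ)

  minCost : ℕ → ℕ
  minCost a = minList (map (sumτ g) (perms (upTo a)))

  sumτ≡cost : ∀ {a τ} → τ ↭ upTo a → sumτ g τ ≡ cost (upTo a) τ
  sumτ≡cost {τ = τ} τ↭ = cong (λ n → cost (upTo n) τ) (length-↭-upTo τ↭)

  minCost-≤ : ∀ {a τ} → τ ↭ upTo a → minCost a ≤ cost (upTo a) τ
  minCost-≤ {a} τ↭ = NP.≤-trans (minList-perms-≤ (sumτ g) (upTo a) τ↭) (NP.≤-reflexive (sumτ≡cost τ↭))

  minCost-attained : ∀ a → ∃ λ τ → τ ↭ upTo a × minCost a ≡ cost (upTo a) τ
  minCost-attained a with minList-perms-attained (sumτ g) (upTo a)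
  ... | τ , τ↭ , eq = τ , τ↭ , trans eq (sumτ≡cost τ↭)

  cost-++ : ∀ is {τ} is′ τ′ → length is ≡ length τ → cost (is ++ is′) (τ ++ τ′) ≡ cost is τ + cost is′ τ′
  cost-++ []       {[]}    _   _  _   = refl
  cost-++ (i ∷ is) {j ∷ τ} is′ τ′ len =
    trans (cong (g i j ℕ.+_) (cost-++ is is′ τ′ (NP.suc-injective len))) (sym (NP.+-assoc (g i j) _ _))

  cost-∷ʳ : ∀ is i {τ} j → length is ≡ length τ → cost (is ∷ʳ i) (τ ∷ʳ j) ≡ cost is τ + g i j
  cost-∷ʳ is i {τ} j len = trans (cost-++ is [ i ] [ j ] len) (cong (cost is τ ℕ.+_) (NP.+-identityʳ (g i j)))

  -- Row i₀ (matched with j) and column j₀ (matched with some row i) are deleted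
  -- by matching i with j instead.
  remove-last-row : ∀ K i₀ j₀ → (∀ i j → g i j ≤ g i j₀ + g i₀ j + K) →
    ∀ is {js τ} → length τ ≡ suc (length is) → τ ↭ j₀ ∷ js →
    ∃ λ τ′ → τ′ ↭ js × cost is τ′ ≤ cost (is ∷ʳ i₀) τ + K
  remove-last-row K i₀ j₀ triangle is {js} {τ} len τ↭ with unsnoc τ (length is) len
  ... | τ₀ , j , refl , len₀ with ∈-++⁻ τ₀ (∈-resp-↭ (↭-sym τ↭) (here refl))
  ... | inj₂ (here refl) =
    τ₀ , ↭-trans (↭-reflexive (sym (LP.++-identityʳ τ₀))) (drop-mid τ₀ [] τ↭) ,
    NP.≤-trans (NP.m≤m+n (cost is τ₀) (g i₀ j₀))
      (NP.≤-trans (NP.≤-reflexive (sym (cost-∷ʳ is i₀ j₀ (sym len₀)))) (NP.m≤m+n _ K))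
  ... | inj₁ j₀∈τ₀ with ∈-∃++ j₀∈τ₀
  ... | τ₁ , τ₂ , refl with split-like is τ₁ τ₂ j₀ (sym len₀)
  ... | is₁ , i , is₂ , refl , len₁ = τ₁ ++ j ∷ τ₂ , τ′↭ , cost≤
    where
    τ′↭ : τ₁ ++ j ∷ τ₂ ↭ js
    τ′↭ = ↭-trans (++⁺ˡ τ₁ (∷↭∷ʳ j τ₂))
                  (drop-mid τ₁ [] (↭-trans (↭-reflexive (sym (LP.++-assoc τ₁ (j₀ ∷ τ₂) [ j ]))) τ↭))
    open NP.≤-Reasoning
    open ℕ-Solver.+-*-Solver
    cost≤ : cost (is₁ ++ i ∷ is₂) (τ₁ ++ j ∷ τ₂) ≤ cost ((is₁ ++ i ∷ is₂) ∷ʳ i₀) ((τ₁ ++ j₀ ∷ τ₂) ∷ʳ j) + K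
    cost≤ = begin
      cost (is₁ ++ i ∷ is₂) (τ₁ ++ j ∷ τ₂)
        ≡⟨ cost-++ is₁ (i ∷ is₂) (j ∷ τ₂) len₁ ⟩
      cost is₁ τ₁ + (g i j + cost is₂ τ₂)
        ≤⟨ NP.+-monoʳ-≤ (cost is₁ τ₁) (NP.+-monoˡ-≤ (cost is₂ τ₂) (triangle i j)) ⟩
      cost is₁ τ₁ + (g i j₀ + g i₀ j + K + cost is₂ τ₂)
        ≡⟨ solve 5 (λ x a b k y → x :+ (a :+ b :+ k :+ y) := x :+ (a :+ y) :+ b :+ k)
                 refl (cost is₁ τ₁) (g i j₀) (g i₀ j) K (cost is₂ τ₂) ⟩
      cost is₁ τ₁ + (g i j₀ + cost is₂ τ₂) + g i₀ j + K
        ≡⟨ cong (λ z → z + g i₀ j + K) (cost-++ is₁ (i ∷ is₂) (j₀ ∷ τ₂) len₁) ⟨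
      cost (is₁ ++ i ∷ is₂) (τ₁ ++ j₀ ∷ τ₂) + g i₀ j + K
        ≡⟨ cong (_+ K) (cost-∷ʳ (is₁ ++ i ∷ is₂) i₀ j (sym len₀)) ⟨
      cost ((is₁ ++ i ∷ is₂) ∷ʳ i₀) ((τ₁ ++ j₀ ∷ τ₂) ∷ʳ j) + K ∎

  module _ {M} (g≤M : ∀ i j → g i j ≤ M) where

    minCost-suc-≤ : ∀ a → minCost (suc a) ≤ minCost a + M
    minCost-suc-≤ a with minCost-attained a
    ... | τ , τ↭ , minCost≡ = begin
      minCost (suc a)                   ≤⟨ minCost-≤ τa↭ ⟩
      cost (upTo (suc a)) (τ ∷ʳ a)      ≡⟨ cong (λ is → cost is (τ ∷ʳ a)) (LP.upTo-∷ʳ a) ⟨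
      cost (upTo a ∷ʳ a) (τ ∷ʳ a)       ≡⟨ cost-∷ʳ (upTo a) a a (trans (LP.length-upTo a) (sym (length-↭-upTo τ↭))) ⟩
      cost (upTo a) τ + g a a           ≤⟨ NP.+-mono-≤ (NP.≤-reflexive (sym minCost≡)) (g≤M a a) ⟩
      minCost a + M                     ∎
      where
      open NP.≤-Reasoning
      τa↭ : τ ∷ʳ a ↭ upTo (suc a)
      τa↭ = ↭-trans (++⁺ τ↭ ↭-refl) (↭-reflexive (LP.upTo-∷ʳ a))

    minCost-≤-suc : ∀ a → minCost a ≤ minCost (suc a) + M
    minCost-≤-suc a with minCost-attained (suc a)
    ... | τ , τ↭ , minCost≡ with remove-last-row M a a triangle (upTo a) len τ↭′
      where
      triangle : ∀ i j → g i j ≤ g i a + g a j + M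
      triangle i j = NP.≤-trans (g≤M i j) (NP.m≤n+m M _)
      len : length τ ≡ suc (length (upTo a))
      len = trans (length-↭-upTo τ↭) (cong suc (sym (LP.length-upTo a)))
      τ↭′ : τ ↭ a ∷ upTo a
      τ↭′ = ↭-trans τ↭ (↭-trans (↭-reflexive (sym (LP.upTo-∷ʳ a))) (↭-sym (∷↭∷ʳ a (upTo a))))
    ... | τ′ , τ′↭ , cost≤ = begin
      minCost a                         ≤⟨ minCost-≤ τ′↭ ⟩
      cost (upTo a) τ′                  ≤⟨ cost≤ ⟩
      cost (upTo a ∷ʳ a) τ + M          ≡⟨ cong (λ is → cost is τ + M) (LP.upTo-∷ʳ a) ⟩
      cost (upTo (suc a)) τ + M         ≡⟨ cong (_+ M) minCost≡ ⟨
      minCost (suc a) + M               ∎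
      where open NP.≤-Reasoning

  ZeroTriangle : Set
  ZeroTriangle = ∀ {i₀ j₀} → g i₀ j₀ ≡ 0 → ∀ i j → g i j ≤ g i j₀ + g i₀ j

  module ZeroBlock (zero-triangle : ZeroTriangle) (a m : ℕ) (σ : ℕ → ℕ)
                   (g-σ : ∀ k → g k (σ k) ≡ 0)
                   (σ↭ : map σ (applyUpTo (a ℕ.+_) m) ↭ applyUpTo (a ℕ.+_) m) where

    block : ℕ → List ℕ
    block k = map σ (applyUpTo (a ℕ.+_) k)

    cost-σ : ∀ is → cost is (map σ is) ≡ 0
    cost-σ []       = refl
    cost-σ (i ∷ is) = cong₂ _+_ (g-σ i) (cost-σ is)

    minCost-+-≤ : minCost (a + m) ≤ minCost a
    minCost-+-≤ with minCost-attained a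
    ... | τ , τ↭ , minCost≡ = begin
      minCost (a + m)
        ≤⟨ minCost-≤ τ+↭ ⟩
      cost (upTo (a + m)) (τ ++ block m)
        ≡⟨ cong (λ is → cost is (τ ++ block m)) (upTo-+ a m) ⟩
      cost (upTo a ++ applyUpTo (a ℕ.+_) m) (τ ++ block m)
        ≡⟨ cost-++ (upTo a) _ (block m) (trans (LP.length-upTo a) (sym (length-↭-upTo τ↭))) ⟩
      cost (upTo a) τ + cost (applyUpTo (a ℕ.+_) m) (block m)
        ≡⟨ cong₂ _+_ (sym minCost≡) (cost-σ (applyUpTo (a ℕ.+_) m)) ⟩
      minCost a + 0
        ≡⟨ NP.+-identityʳ _ ⟩
      minCost a ∎
      where
      open NP.≤-Reasoning
      τ+↭ : τ ++ block m ↭ upTo (a + m)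
      τ+↭ = ↭-trans (++⁺ τ↭ σ↭) (↭-reflexive (sym (upTo-+ a m)))

    length-columns : ∀ k → length (upTo a ++ block k) ≡ a + k
    length-columns k = trans (LP.length-++ (upTo a))
      (cong₂ _+_ (LP.length-upTo a) (trans (LP.length-map σ (applyUpTo (a ℕ.+_) k)) (LP.length-applyUpTo (a ℕ.+_) k)))

    -- The block is peeled off one row at a time; ZeroTriangle makes each removal free.
    remove-block : ∀ k {τ} → τ ↭ upTo a ++ block k →
                   ∃ λ τ′ → τ′ ↭ upTo a × cost (upTo a) τ′ ≤ cost (upTo (a + k)) τ
    remove-block zero    {τ} τ↭ =
      τ , ↭-trans τ↭ (↭-reflexive (LP.++-identityʳ (upTo a))) ,
      NP.≤-reflexive (cong (λ n → cost (upTo n) τ) (sym (NP.+-identityʳ a)))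
    remove-block (suc k) {τ} τ↭ with remove-last-row 0 (a + k) (σ (a + k)) triangle (upTo (a + k)) len τ↭′
      where
      triangle : ∀ i j → g i j ≤ g i (σ (a + k)) + g (a + k) j + 0
      triangle i j = NP.≤-trans (zero-triangle (g-σ (a + k)) i j) (NP.m≤m+n _ 0)
      columns-suc : upTo a ++ block (suc k) ≡ (upTo a ++ block k) ∷ʳ σ (a + k)
      columns-suc = trans (cong (λ ks → upTo a ++ map σ ks) (sym (LP.applyUpTo-∷ʳ (a ℕ.+_) k)))
        (trans (cong (upTo a ++_) (LP.map-++ σ (applyUpTo (a ℕ.+_) k) [ a + k ]))
               (sym (LP.++-assoc (upTo a) (block k) [ σ (a + k) ])))
      τ↭′ : τ ↭ σ (a + k) ∷ (upTo a ++ block k)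
      τ↭′ = ↭-trans τ↭ (↭-trans (↭-reflexive columns-suc) (↭-sym (∷↭∷ʳ (σ (a + k)) (upTo a ++ block k))))
      len : length τ ≡ suc (length (upTo (a + k)))
      len = trans (↭-length τ↭) (trans (length-columns (suc k))
              (trans (NP.+-suc a k) (cong suc (sym (LP.length-upTo (a + k))))))
    ... | τ″ , τ″↭ , cost≤ with remove-block k τ″↭
    ... | τ′ , τ′↭ , cost′≤ = τ′ , τ′↭ , NP.≤-trans cost′≤ (NP.≤-trans cost≤ (NP.≤-reflexive rows-suc))
      where
      rows-suc : cost (upTo (a + k) ∷ʳ (a + k)) τ + 0 ≡ cost (upTo (a + suc k)) τ
      rows-suc = trans (NP.+-identityʳ _)
        (cong (λ is → cost is τ) (trans (LP.upTo-∷ʳ (a + k)) (cong upTo (sym (NP.+-suc a k)))))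

    minCost-≤-+ : minCost a ≤ minCost (a + m)
    minCost-≤-+ with minCost-attained (a + m)
    ... | τ , τ↭ , minCost≡ with remove-block m (↭-trans τ↭ (↭-trans (↭-reflexive (upTo-+ a m)) (++⁺ˡ (upTo a) (↭-sym σ↭))))
    ... | τ′ , τ′↭ , cost≤ = NP.≤-trans (minCost-≤ τ′↭) (NP.≤-trans cost≤ (NP.≤-reflexive (sym minCost≡)))

    minCost-+ : minCost (a + m) ≡ minCost a
    minCost-+ = NP.≤-antisym minCost-+-≤ minCost-≤-+

-- The matrix of residues of e⁻¹(p i − j + t)

module ResidueMatrix (p dm : ℕ) (einv t : ℤ) where
  open Residues dm

  entry : ℕ → ℕ → ℤ
  entry i j = einv ℤ.* ((+ p ℤ.* + i) ℤ.- + j ℤ.+ t)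

  g : ℕ → ℕ → ℕ
  g i j = res D (entry i j)

  -- For this g, C p einv D t n unfolds to minCost (suc n).
  open Assignment g public

  Cpred≡minCost : ∀ n → Cpred p einv D t n ≡ minCost n
  Cpred≡minCost zero    = refl
  Cpred≡minCost (suc n) = refl

  g≤dm : ∀ i j → g i j ≤ dm
  g≤dm i j = NP.≤-pred (res-< (entry i j))

  entry-rectangle : ∀ i j i₀ j₀ → entry i j ≡ entry i j₀ ℤ.+ entry i₀ j ℤ.+ ℤ.- entry i₀ j₀
  entry-rectangle i j i₀ j₀ =
    solve 6 (λ c P J J₀ T P₀ → c :* (P :- J :+ T) := c :* (P :- J₀ :+ T) :+ c :* (P₀ :- J :+ T) :+ :- (c :* (P₀ :- J₀ :+ T)))
          refl einv (+ p ℤ.* + i) (+ j) (+ j₀) t (+ p ℤ.* + i₀)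
    where open ℤ-Solver.+-*-Solver

  g-zero-triangle : ZeroTriangle
  g-zero-triangle {i₀} {j₀} g≡0 i j = begin
    g i j
      ≡⟨ cong (res D) (entry-rectangle i j i₀ j₀) ⟩
    res D (entry i j₀ ℤ.+ entry i₀ j ℤ.+ ℤ.- entry i₀ j₀)
      ≡⟨ cong (λ z → res D (entry i j₀ ℤ.+ entry i₀ j ℤ.+ ℤ.- z)) (res≡0⇒multiple (entry i₀ j₀) g≡0) ⟩
    res D (entry i j₀ ℤ.+ entry i₀ j ℤ.+ ℤ.- (q ℤ.* + D))
      ≡⟨ cong (λ z → res D (entry i j₀ ℤ.+ entry i₀ j ℤ.+ z)) (ZP.neg-distribˡ-* q (+ D)) ⟩
    res D (entry i j₀ ℤ.+ entry i₀ j ℤ.+ ℤ.- q ℤ.* + D)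
      ≡⟨ res-+-multiple (entry i j₀ ℤ.+ entry i₀ j) (ℤ.- q) ⟩
    res D (entry i j₀ ℤ.+ entry i₀ j)
      ≤⟨ res-+-≤ (entry i j₀) (entry i₀ j) ⟩
    g i j₀ + g i₀ j ∎
    where
    open NP.≤-Reasoning
    q = entry i₀ j₀ /ℕ D

  module Diagonal (a : ℕ) where

    -- the j ∈ [a, a + d) with p k − j + t ≡ 0 (mod d)
    column : ℕ → ℕ
    column k = a + res D (+ p ℤ.* + k ℤ.+ (t ℤ.- + a))

    g-column : ∀ k → g k (column k) ≡ 0
    g-column k = trans (cong (res D) entry≡) (res-multiple (einv ℤ.* (y /ℕ D)))
      where
      open ≡-Reasoning
      open ℤ-Solver.+-*-Solver
      y = + p ℤ.* + k ℤ.+ (t ℤ.- + a)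
      h = res D y
      entry≡ : entry k (column k) ≡ einv ℤ.* (y /ℕ D) ℤ.* + D
      entry≡ = begin
        einv ℤ.* ((+ p ℤ.* + k) ℤ.- + (a + h) ℤ.+ t)
          ≡⟨ cong (λ z → einv ℤ.* ((+ p ℤ.* + k) ℤ.- z ℤ.+ t)) (ZP.pos-+ a h) ⟩
        einv ℤ.* ((+ p ℤ.* + k) ℤ.- (+ a ℤ.+ + h) ℤ.+ t)
          ≡⟨ cong (einv ℤ.*_) (solve 4 (λ P A H T → P :- (A :+ H) :+ T := (P :+ (T :- A)) :- H)
                                     refl (+ p ℤ.* + k) (+ a) (+ h) t) ⟩
        einv ℤ.* (y ℤ.- + h)
          ≡⟨ cong (λ z → einv ℤ.* (z ℤ.- + h)) (res-decomposition y) ⟩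
        einv ℤ.* ((+ h ℤ.+ (y /ℕ D) ℤ.* + D) ℤ.- + h)
          ≡⟨ cong (einv ℤ.*_) (solve 2 (λ H X → (H :+ X) :- H := X) refl (+ h) ((y /ℕ D) ℤ.* + D)) ⟩
        einv ℤ.* ((y /ℕ D) ℤ.* + D)
          ≡⟨ ZP.*-assoc einv (y /ℕ D) (+ D) ⟨
        einv ℤ.* (y /ℕ D) ℤ.* + D ∎

    column-window-↭ : Cancellable (+ p) → map column (applyUpTo (a ℕ.+_) D) ↭ applyUpTo (a ℕ.+_) D
    column-window-↭ cp = ↭-trans (↭-reflexive (LP.map-∘ (applyUpTo (a ℕ.+_) D)))
      (↭-trans (map⁺ (a ℕ.+_) (res-affine-window-↭ (+ p) cp (t ℤ.- + a) a))
               (↭-reflexive (LP.map-applyUpTo (λ k → k) (a ℕ.+_) D)))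

  minCost-+D : Cancellable (+ p) → ∀ a → minCost (a + D) ≡ minCost a
  minCost-+D cp a = ZeroBlock.minCost-+ g-zero-triangle a D column g-column (column-window-↭ cp)
    where open Diagonal a

  module Overflows (α : ℤ) where

    Rarg rarg : ℕ → ℤ
    Rarg i = einv ℤ.* ((+ p ℤ.* + i) ℤ.+ α)
    rarg j = einv ℤ.* (t ℤ.- α ℤ.- + j)

    Rα rα : ℕ → ℕ
    Rα = R p einv D α
    rα = r einv D t α

    overflow : ℕ → ℕ → Bool
    overflow i j = D ≤ᵇ (Rα i + rα j)

    overflows : List ℕ → ℕ
    overflows τ = countTrue (zipWith overflow (upTo (length τ)) τ)

    -- Cbold p einv D t n α unfolds to maxOverflows (suc n).
    maxOverflows : ℕ → ℕ
    maxOverflows a = maxList (map overflows (perms (upTo a)))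

    ΣRr : ℕ → ℕ
    ΣRr a = sum (map (λ i → Rα i + rα i) (upTo a))

    𝟙 : Bool → ℕ
    𝟙 b = if b then 1 else 0

    entry-split : ∀ i j → entry i j ≡ Rarg i ℤ.+ rarg j
    entry-split i j = trans
      (cong (einv ℤ.*_) (solve 4 (λ P J T A → P :- J :+ T := (P :+ A) :+ (T :- A :- J)) refl (+ p ℤ.* + i) (+ j) t α))
      (ZP.*-distribˡ-+ einv _ _)
      where open ℤ-Solver.+-*-Solver

    g+D𝟙[overflow] : ∀ i j → g i j + D * 𝟙 (overflow i j) ≡ Rα i + rα j
    g+D𝟙[overflow] i j with overflow i j | NP.≤ᵇ-reflects-≤ D (Rα i + rα j)
    ... | true  | ofʸ D≤ = trans (cong (g i j ℕ.+_) (NP.*-identityʳ D))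
      (trans (cong (λ z → res D z + D) (entry-split i j)) (res-+-≥ (Rarg i) (rarg j) D≤))
    ... | false | ofⁿ D≰ = trans (cong (g i j ℕ.+_) (NP.*-zeroʳ D))
      (trans (NP.+-identityʳ _) (trans (cong (res D) (entry-split i j)) (res-+-< (Rarg i) (rarg j) (NP.≰⇒> D≰))))

    cost+D*overflows : ∀ is {τ} → length is ≡ length τ →
      cost is τ + D * countTrue (zipWith overflow is τ) ≡ sum (map Rα is) + sum (map rα τ)
    cost+D*overflows []       {[]}    _   = NP.*-zeroʳ D
    cost+D*overflows (i ∷ is) {j ∷ τ} len = begin
      (g i j + cost is τ) + D * (𝟙 (overflow i j) + countTrue (zipWith overflow is τ))
        ≡⟨ solve 5 (λ a b c e d → (a :+ b) :+ d :* (c :+ e) := (a :+ d :* c) :+ (b :+ d :* e))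
                 refl (g i j) (cost is τ) (𝟙 (overflow i j)) (countTrue (zipWith overflow is τ)) D ⟩
      (g i j + D * 𝟙 (overflow i j)) + (cost is τ + D * countTrue (zipWith overflow is τ))
        ≡⟨ cong₂ _+_ (g+D𝟙[overflow] i j) (cost+D*overflows is (NP.suc-injective len)) ⟩
      (Rα i + rα j) + (sum (map Rα is) + sum (map rα τ))
        ≡⟨ solve 4 (λ a b c e → (a :+ b) :+ (c :+ e) := (a :+ c) :+ (b :+ e))
                 refl (Rα i) (rα j) (sum (map Rα is)) (sum (map rα τ)) ⟩
      (Rα i + sum (map Rα is)) + (rα j + sum (map rα τ)) ∎
      where
      open ≡-Reasoning
      open ℕ-Solver.+-*-Solver

    cost+D*overflows-↭ : ∀ {a τ} → τ ↭ upTo a → cost (upTo a) τ + D * overflows τ ≡ ΣRr a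
    cost+D*overflows-↭ {a} {τ} τ↭ = begin
      cost (upTo a) τ + D * overflows τ
        ≡⟨ cong (λ n → cost (upTo a) τ + D * countTrue (zipWith overflow (upTo n) τ)) (length-↭-upTo τ↭) ⟩
      cost (upTo a) τ + D * countTrue (zipWith overflow (upTo a) τ)
        ≡⟨ cost+D*overflows (upTo a) (trans (LP.length-upTo a) (sym (length-↭-upTo τ↭))) ⟩
      sum (map Rα (upTo a)) + sum (map rα τ)
        ≡⟨ cong (sum (map Rα (upTo a)) ℕ.+_) (SP.sum-↭ (map⁺ rα τ↭)) ⟩
      sum (map Rα (upTo a)) + sum (map rα (upTo a))
        ≡⟨ sum-map-+ Rα rα (upTo a) ⟨
      ΣRr a ∎
      where open ≡-Reasoning

    minCost+D*maxOverflows : ∀ a → minCost a + D * maxOverflows a ≡ ΣRr a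
    minCost+D*maxOverflows a with minCost-attained a | maxList-perms-attained overflows (upTo a)
    ... | τ₀ , τ₀↭ , minCost≡ | τ₁ , τ₁↭ , max≡ = NP.≤-antisym ≤ΣRr ΣRr≤
      where
      ≤ΣRr : minCost a + D * maxOverflows a ≤ ΣRr a
      ≤ΣRr = NP.≤-trans (NP.+-mono-≤ (minCost-≤ τ₁↭) (NP.≤-reflexive (cong (D *_) max≡)))
                        (NP.≤-reflexive (cost+D*overflows-↭ τ₁↭))
      ΣRr≤ : ΣRr a ≤ minCost a + D * maxOverflows a
      ΣRr≤ = NP.≤-trans (NP.≤-reflexive (sym (cost+D*overflows-↭ τ₀↭)))
               (NP.+-mono-≤ (NP.≤-reflexive (sym minCost≡)) (NP.*-monoʳ-≤ D (maxList-perms-≥ overflows (upTo a) τ₀↭)))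

    minCost≡ΣRr-D*maxOverflows : ∀ a → + minCost a ≡ + ΣRr a ℤ.- + D ℤ.* + maxOverflows a
    minCost≡ΣRr-D*maxOverflows a = trans (m+n≡s⇒m≡s-n (minCost+D*maxOverflows a))
      (cong (λ z → + ΣRr a ℤ.- z) (ZP.pos-* D (maxOverflows a)))

    ΣRr-+D : Cancellable einv → Cancellable (+ p) → ∀ a → ΣRr (a + D) ≡ ΣRr a + D * dm
    ΣRr-+D ce cp a = begin
      ΣRr (a + D)                                          ≡⟨ cong (λ is → sum (map Rr is)) (upTo-+ a D) ⟩
      sum (map Rr (upTo a ++ window))                      ≡⟨ cong sum (LP.map-++ Rr (upTo a) window) ⟩
      sum (map Rr (upTo a) ++ map Rr window)               ≡⟨ SP.sum-++ (map Rr (upTo a)) (map Rr window) ⟩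
      ΣRr a + sum (map Rr window)                          ≡⟨ cong (ΣRr a ℕ.+_) (sum-map-+ Rα rα window) ⟩
      ΣRr a + (sum (map Rα window) + sum (map rα window))  ≡⟨ cong (ΣRr a ℕ.+_) (cong₂ _+_ ΣR≡ Σr≡) ⟩
      ΣRr a + (sum (upTo D) + sum (upTo D))                ≡⟨ cong (ΣRr a ℕ.+_) (sum-upTo-double D) ⟩
      ΣRr a + D * dm                                       ∎
      where
      open ≡-Reasoning
      open ℤ-Solver.+-*-Solver
      Rr = λ i → Rα i + rα i
      window = applyUpTo (a ℕ.+_) D
      ΣR≡ : sum (map Rα window) ≡ sum (upTo D)
      ΣR≡ = trans (cong sum (LP.map-cong (λ k → cong (res D)
                    (solve 4 (λ c P K A → c :* (P :* K :+ A) := (c :* P) :* K :+ c :* A)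
                           refl einv (+ p) (+ k) α)) window))
                  (SP.sum-↭ (res-affine-window-↭ (einv ℤ.* + p) (cancellable-* einv (+ p) ce cp) (einv ℤ.* α) a))
      Σr≡ : sum (map rα window) ≡ sum (upTo D)
      Σr≡ = trans (cong sum (LP.map-cong (λ k → cong (res D)
                    (solve 4 (λ c T A K → c :* (T :- A :- K) := (:- c) :* K :+ c :* (T :- A))
                           refl einv t α (+ k))) window))
                  (SP.sum-↭ (res-affine-window-↭ (ℤ.- einv) (cancellable-neg einv ce) (einv ℤ.* (t ℤ.- α)) a))

    maxOverflows-+D : Cancellable einv → Cancellable (+ p) → ∀ a → maxOverflows (a + D) ≡ dm + maxOverflows a
    maxOverflows-+D ce cp a = NP.*-cancelˡ-≡ (maxOverflows (a + D)) (dm + maxOverflows a) D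
      (NP.+-cancelˡ-≡ (minCost a) _ _ (begin
        minCost a + D * maxOverflows (a + D)
          ≡⟨ cong (_+ D * maxOverflows (a + D)) (minCost-+D cp a) ⟨
        minCost (a + D) + D * maxOverflows (a + D)
          ≡⟨ minCost+D*maxOverflows (a + D) ⟩
        ΣRr (a + D)
          ≡⟨ ΣRr-+D ce cp a ⟩
        ΣRr a + D * dm
          ≡⟨ cong (_+ D * dm) (minCost+D*maxOverflows a) ⟨
        minCost a + D * maxOverflows a + D * dm
          ≡⟨ solve 3 (λ c d b → c :+ con D :* b :+ con D :* d := c :+ con D :* (d :+ b))
                   refl (minCost a) dm (maxOverflows a) ⟩
        minCost a + D * (dm + maxOverflows a) ∎))
      where
      open ≡-Reasoning
      open ℕ-Solver.+-*-Solver

private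
  ℕ→ℚᵘ : ℕ → ℚᵘ.ℚᵘ
  ℕ→ℚᵘ n = ℚᵘ.mkℚᵘ (+ n) 0

  toℚᵘ-ℚℕ : ∀ n → toℚᵘ (ℚℕ n) ℚᵘ.≃ ℕ→ℚᵘ n
  toℚᵘ-ℚℕ n = QP.toℚᵘ-fromℚᵘ (ℕ→ℚᵘ n)

ℚℕ-+ : ∀ m n → ℚℕ (m ℕ.+ n) ≡ ℚℕ m ℚ.+ ℚℕ n
ℚℕ-+ m n = QP.toℚᵘ-injective (begin
  toℚᵘ (ℚℕ (m ℕ.+ n))
    ≈⟨ toℚᵘ-ℚℕ (m ℕ.+ n) ⟩
  ℕ→ℚᵘ (m ℕ.+ n)
    ≈⟨ ℚᵘP.≃-reflexive (cong (λ z → ℚᵘ.mkℚᵘ z 0)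
         (trans (ZP.pos-+ m n) (sym (cong₂ ℤ._+_ (ZP.*-identityʳ (+ m)) (ZP.*-identityʳ (+ n)))))) ⟩
  ℕ→ℚᵘ m ℚᵘ.+ ℕ→ℚᵘ n
    ≈⟨ ℚᵘP.+-cong (ℚᵘP.≃-sym (toℚᵘ-ℚℕ m)) (ℚᵘP.≃-sym (toℚᵘ-ℚℕ n)) ⟩
  toℚᵘ (ℚℕ m) ℚᵘ.+ toℚᵘ (ℚℕ n)
    ≈⟨ QP.toℚᵘ-homo-+ (ℚℕ m) (ℚℕ n) ⟨
  toℚᵘ (ℚℕ m ℚ.+ ℚℕ n) ∎)
  where open ℚᵘP.≃-Reasoning

ℚℕ-* : ∀ m n → ℚℕ (m ℕ.* n) ≡ ℚℕ m ℚ.* ℚℕ n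
ℚℕ-* m n = QP.toℚᵘ-injective (begin
  toℚᵘ (ℚℕ (m ℕ.* n))            ≈⟨ toℚᵘ-ℚℕ (m ℕ.* n) ⟩
  ℕ→ℚᵘ (m ℕ.* n)                 ≈⟨ ℚᵘP.≃-reflexive (cong (λ z → ℚᵘ.mkℚᵘ z 0) (ZP.pos-* m n)) ⟩
  ℕ→ℚᵘ m ℚᵘ.* ℕ→ℚᵘ n             ≈⟨ ℚᵘP.*-cong (ℚᵘP.≃-sym (toℚᵘ-ℚℕ m)) (ℚᵘP.≃-sym (toℚᵘ-ℚℕ n)) ⟩
  toℚᵘ (ℚℕ m) ℚᵘ.* toℚᵘ (ℚℕ n)   ≈⟨ QP.toℚᵘ-homo-* (ℚℕ m) (ℚℕ n) ⟨
  toℚᵘ (ℚℕ m ℚ.* ℚℕ n)             ∎)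
  where open ℚᵘP.≃-Reasoning

ℚℕ-0 : ℚℕ 0 ≡ 0ℚ
ℚℕ-0 = QP.0/n≡0 1

recip-*-ℚℕ : ∀ m n → recip (suc m ℕ.* suc n) ℚ.* ℚℕ (suc m) ≡ recip (suc n)
recip-*-ℚℕ m n = QP.toℚᵘ-injective (begin
  toℚᵘ (recip (suc m ℕ.* suc n) ℚ.* ℚℕ (suc m))
    ≈⟨ QP.toℚᵘ-homo-* (recip (suc m ℕ.* suc n)) (ℚℕ (suc m)) ⟩
  toℚᵘ (recip (suc m ℕ.* suc n)) ℚᵘ.* toℚᵘ (ℚℕ (suc m))
    ≈⟨ ℚᵘP.*-cong (QP.toℚᵘ-fromℚᵘ (ℚᵘ.mkℚᵘ (+ 1) (n ℕ.+ m ℕ.* suc n))) (toℚᵘ-ℚℕ (suc m)) ⟩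
  ℚᵘ.mkℚᵘ (+ 1) (n ℕ.+ m ℕ.* suc n) ℚᵘ.* ℕ→ℚᵘ (suc m)
    ≈⟨ ℚᵘ.*≡* cross ⟩
  ℚᵘ.mkℚᵘ (+ 1) n
    ≈⟨ QP.toℚᵘ-fromℚᵘ (ℚᵘ.mkℚᵘ (+ 1) n) ⟨
  toℚᵘ (recip (suc n)) ∎)
  where
  open ℚᵘP.≃-Reasoning
  cross : (+ 1 ℤ.* + suc m) ℤ.* + suc n ≡ + 1 ℤ.* + (suc (n ℕ.+ m ℕ.* suc n) ℕ.* 1)
  cross = trans (cong (ℤ._* + suc n) (ZP.*-identityˡ (+ suc m)))
    (trans (sym (ZP.pos-* (suc m) (suc n)))
      (trans (cong +_ (sym (NP.*-identityʳ (suc m ℕ.* suc n)))) (sym (ZP.*-identityˡ _))))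

recip-*-ℚℕ-self : ∀ m → recip (suc m) ℚ.* ℚℕ (suc m) ≡ ℚ.1ℚ
recip-*-ℚℕ-self m = trans (cong (λ n → recip n ℚ.* ℚℕ (suc m)) (sym (NP.*-identityʳ (suc m)))) (recip-*-ℚℕ m 0)

recip-*-*-ℚℕ : ∀ {x y} n → 1 ℕ.≤ x → 1 ℕ.≤ y → recip (x * suc n * y) ℚ.* ℚℕ (x * y) ≡ recip (suc n)
recip-*-*-ℚℕ {suc x} {suc y} n _ _ =
  trans (cong (λ m → recip m ℚ.* ℚℕ (suc x * suc y))
              (solve 3 (λ x y d → x :* d :* y := (x :* y) :* d) refl (suc x) (suc y) (suc n)))
        (recip-*-ℚℕ (y + x * suc y) n)
  where open ℕ-Solver.+-*-Solver

ℚℕ-nonneg : ∀ n → 0ℚ ℚ.≤ ℚℕ n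
ℚℕ-nonneg n = QP.nonNegative⁻¹ (ℚℕ n) {{QP.normalize-nonNeg n 1}}

recip-nonneg : ∀ m → 0ℚ ℚ.≤ recip m
recip-nonneg zero    = QP.≤-refl
recip-nonneg (suc m) = QP.nonNegative⁻¹ (recip (suc m)) {{QP.normalize-nonNeg 1 (suc m)}}

*-nonneg : ∀ {x y} → 0ℚ ℚ.≤ x → 0ℚ ℚ.≤ y → 0ℚ ℚ.≤ x ℚ.* y
*-nonneg {x} {y} 0≤x 0≤y =
  QP.nonNegative⁻¹ (x ℚ.* y) {{QP.nonNeg*nonNeg⇒nonNeg x {{ℚ.nonNegative 0≤x}} y {{ℚ.nonNegative 0≤y}}}}

foldr-+-init : ∀ (xs : List ℚ) z → foldr ℚ._+_ z xs ≡ foldr ℚ._+_ 0ℚ xs ℚ.+ z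
foldr-+-init []       z = sym (QP.+-identityˡ z)
foldr-+-init (x ∷ xs) z = trans (cong (x ℚ.+_) (foldr-+-init xs z)) (sym (QP.+-assoc x _ z))

difference-from-sums : ∀ x y z w c → x ℚ.+ y ≡ (z ℚ.+ w) ℚ.+ c → x ℚ.- w ≡ c ℚ.+ (z ℚ.- y)
difference-from-sums x y z w c eq = begin
  x ℚ.- w                          ≡⟨ solve 3 (λ x y w → x :- w := (x :+ y) :- (y :+ w)) refl x y w ⟩
  (x ℚ.+ y) ℚ.- (y ℚ.+ w)          ≡⟨ cong (ℚ._- (y ℚ.+ w)) eq ⟩
  ((z ℚ.+ w) ℚ.+ c) ℚ.- (y ℚ.+ w)  ≡⟨ solve 4 (λ y z w c → ((z :+ w) :+ c) :- (y :+ w) := c :+ (z :- y)) refl y z w c ⟩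
  c ℚ.+ (z ℚ.- y)                  ∎
  where
  open ≡-Reasoning
  open ℚ-Solver.+-*-Solver

module LinearForm (ρ κ : ℚ) where

  lin : ℕ → ℕ → ℚ
  lin x y = ℚℕ x ℚ.* ρ ℚ.+ κ ℚ.* ℚℕ y

  lin-+ : ∀ x₁ x₂ y₁ y₂ → lin (x₁ ℕ.+ x₂) (y₁ ℕ.+ y₂) ≡ lin x₁ y₁ ℚ.+ lin x₂ y₂
  lin-+ x₁ x₂ y₁ y₂ = begin
    ℚℕ (x₁ ℕ.+ x₂) ℚ.* ρ ℚ.+ κ ℚ.* ℚℕ (y₁ ℕ.+ y₂)
      ≡⟨ cong₂ (λ a b → a ℚ.* ρ ℚ.+ κ ℚ.* b) (ℚℕ-+ x₁ x₂) (ℚℕ-+ y₁ y₂) ⟩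
    (ℚℕ x₁ ℚ.+ ℚℕ x₂) ℚ.* ρ ℚ.+ κ ℚ.* (ℚℕ y₁ ℚ.+ ℚℕ y₂)
      ≡⟨ solve 6 (λ a b c d r k → (a :+ b) :* r :+ k :* (c :+ d) := (a :* r :+ k :* c) :+ (b :* r :+ k :* d))
               refl (ℚℕ x₁) (ℚℕ x₂) (ℚℕ y₁) (ℚℕ y₂) ρ κ ⟩
    (ℚℕ x₁ ℚ.* ρ ℚ.+ κ ℚ.* ℚℕ y₁) ℚ.+ (ℚℕ x₂ ℚ.* ρ ℚ.+ κ ℚ.* ℚℕ y₂) ∎
    where
    open ≡-Reasoning
    open ℚ-Solver.+-*-Solver

  lin-x0 : ∀ x → lin x 0 ≡ ℚℕ x ℚ.* ρ
  lin-x0 x = trans (cong (λ z → ℚℕ x ℚ.* ρ ℚ.+ κ ℚ.* z) ℚℕ-0)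
    (trans (cong (ℚℕ x ℚ.* ρ ℚ.+_) (QP.*-zeroʳ κ)) (QP.+-identityʳ _))

  lin-0y : ∀ y → lin 0 y ≡ κ ℚ.* ℚℕ y
  lin-0y y = trans (cong (λ z → z ℚ.* ρ ℚ.+ κ ℚ.* ℚℕ y) ℚℕ-0)
    (trans (cong (ℚ._+ κ ℚ.* ℚℕ y) (QP.*-zeroˡ ρ)) (QP.+-identityˡ _))

-- The polygons

module Polygon (p dm : ℕ) (einv : ℤ) (e a u b : ℕ) where
  open Residues dm using (D; Cancellable)

  uₖ : ℕ → ℕ
  uₖ = digit p a u

  E : ℕ
  E = D ∸ e

  Cₖ : ℕ → ℕ → ℕ
  Cₖ k = Cpred p einv D (+ uₖ k)

  module _ (k : ℕ) where
    open ResidueMatrix p dm einv (+ uₖ k)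

    Cₖ-+D : Cancellable (+ p) → ∀ m → Cₖ k (m + D) ≡ Cₖ k m
    Cₖ-+D cp m = trans (Cpred≡minCost (m + D)) (trans (minCost-+D cp m) (sym (Cpred≡minCost m)))

    Cₖ-D* : Cancellable (+ p) → ∀ n → Cₖ k (D * n) ≡ 0
    Cₖ-D* cp zero    = cong (Cₖ k) (NP.*-zeroʳ D)
    Cₖ-D* cp (suc n) = trans (cong (Cₖ k) (trans (NP.*-suc D n) (NP.+-comm D (D * n))))
                             (trans (Cₖ-+D cp (D * n)) (Cₖ-D* cp n))

    Cₖ-suc-≤ : ∀ m → Cₖ k (suc m) ≤ Cₖ k m + dm
    Cₖ-suc-≤ m = subst (λ c → Cₖ k (suc m) ≤ c + dm) (sym (Cpred≡minCost m)) (minCost-suc-≤ g≤dm m)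

    Cₖ-≤-suc : ∀ m → Cₖ k m ≤ Cₖ k (suc m) + dm
    Cₖ-≤-suc m = subst (_≤ Cₖ k (suc m) + dm) (sym (Cpred≡minCost m)) (minCost-≤-suc g≤dm m)

  term : ℕ → ℕ → ℕ
  term k m = m * uₖ k + E * Cₖ k m

  B : ℕ → ℕ
  B m = Σ1to b (λ k → term k m)

  A : ℕ → ℕ
  A m = m * (m ∸ 1)

  U : ℕ
  U = Σ1to b uₖ

  ρ κ : ℚ
  ρ = recip (2 * D)
  κ = recip (b * D * (p ∸ 1))

  open LinearForm ρ κ

  -- P′ n unfolds to lin (A n) (B n).
  P′ : ℕ → ℚ
  P′ = P p a u b e D einv

  A-second-difference : ∀ n c → A (suc n + c) + A n ≡ (A (suc n) + A (n + c)) + 2 * c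
  A-second-difference n c = begin
    A (suc (n + c)) + A n
      ≡⟨ cong (_+ A n) (m[m∸1]+2m (n + c)) ⟨
    (A (n + c) + 2 * (n + c)) + A n
      ≡⟨ solve 4 (λ X Y n c → (X :+ con 2 :* (n :+ c)) :+ Y := ((Y :+ con 2 :* n) :+ X) :+ con 2 :* c)
               refl (A (n + c)) (A n) n c ⟩
    ((A n + 2 * n) + A (n + c)) + 2 * c
      ≡⟨ cong (λ z → (z + A (n + c)) + 2 * c) (m[m∸1]+2m n) ⟩
    (A (suc n) + A (n + c)) + 2 * c ∎
    where
    open ≡-Reasoning
    open ℕ-Solver.+-*-Solver

  B-+D : Cancellable (+ p) → ∀ m → B (m + D) ≡ B m + D * U
  B-+D cp m = begin
    B (m + D)                                  ≡⟨ Σ1to-cong b term-+D ⟩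
    Σ1to b (λ k → term k m + D * uₖ k)         ≡⟨ Σ1to-+ b (λ k → term k m) (λ k → D * uₖ k) ⟩
    B m + Σ1to b (λ k → D * uₖ k)              ≡⟨ cong (B m ℕ.+_) (Σ1to-* b D uₖ) ⟩
    B m + D * U                                ∎
    where
    open ≡-Reasoning
    open ℕ-Solver.+-*-Solver
    term-+D : ∀ k → term k (m + D) ≡ term k m + D * uₖ k
    term-+D k = trans (cong (λ c → (m + D) * uₖ k + E * c) (Cₖ-+D k cp m))
      (solve 4 (λ m d x y → (m :+ d) :* x :+ y := (m :* x :+ y) :+ d :* x) refl m D (uₖ k) (E * Cₖ k m))

  lin-2D-0 : lin (2 * D) 0 ≡ 1ℚ
  lin-2D-0 = trans (lin-x0 (2 * D)) (trans (QP.*-comm (ℚℕ (2 * D)) ρ) (recip-*-ℚℕ-self (dm + 1 * D)))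

  w-+D : Cancellable (+ p) → ∀ n → w p a u b e D einv (n + D) ≡ 1ℚ ℚ.+ w p a u b e D einv n
  w-+D cp n = difference-from-sums (P′ (suc n + D)) (P′ n) (P′ (suc n)) (P′ (n + D)) 1ℚ (begin
    lin (A (suc n + D)) (B (suc n + D)) ℚ.+ lin (A n) (B n)
      ≡⟨ lin-+ (A (suc n + D)) (A n) (B (suc n + D)) (B n) ⟨
    lin (A (suc n + D) + A n) (B (suc n + D) + B n)
      ≡⟨ cong₂ lin (A-second-difference n D) B-second-difference ⟩
    lin ((A (suc n) + A (n + D)) + 2 * D) ((B (suc n) + B (n + D)) + 0)
      ≡⟨ lin-+ (A (suc n) + A (n + D)) (2 * D) (B (suc n) + B (n + D)) 0 ⟩
    lin (A (suc n) + A (n + D)) (B (suc n) + B (n + D)) ℚ.+ lin (2 * D) 0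
      ≡⟨ cong₂ ℚ._+_ (lin-+ (A (suc n)) (A (n + D)) (B (suc n)) (B (n + D))) lin-2D-0 ⟩
    (P′ (suc n) ℚ.+ P′ (n + D)) ℚ.+ 1ℚ ∎)
    where
    open ≡-Reasoning
    open ℕ-Solver.+-*-Solver
    B-second-difference : B (suc n + D) + B n ≡ (B (suc n) + B (n + D)) + 0
    B-second-difference = begin
      B (suc n + D) + B n
        ≡⟨ cong (_+ B n) (B-+D cp (suc n)) ⟩
      (B (suc n) + D * U) + B n
        ≡⟨ solve 3 (λ x y z → (x :+ y) :+ z := (x :+ (z :+ y)) :+ con 0) refl (B (suc n)) (D * U) (B n) ⟩
      (B (suc n) + (B n + D * U)) + 0
        ≡⟨ cong (λ z → (B (suc n) + z) + 0) (B-+D cp n) ⟨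
      (B (suc n) + B (n + D)) + 0 ∎

  B-D* : Cancellable (+ p) → ∀ n → B (D * n) ≡ (D * n) * U
  B-D* cp n = trans (Σ1to-cong b term-D*) (Σ1to-* b (D * n) uₖ)
    where
    term-D* : ∀ k → term k (D * n) ≡ (D * n) * uₖ k
    term-D* k = trans (cong (λ c → (D * n) * uₖ k + E * c) (Cₖ-D* k cp n))
                      (trans (cong ((D * n) * uₖ k ℕ.+_) (NP.*-zeroʳ E)) (NP.+-identityʳ _))

  slope : ℕ → ℚ
  slope m = ℚℕ m ℚ.* recip D ℚ.+ κ ℚ.* ℚℕ U

  slope≡lin : ∀ m → slope m ≡ lin (2 * m) U
  slope≡lin m = cong (ℚ._+ κ ℚ.* ℚℕ U) (sym (begin
    ℚℕ (2 * m) ℚ.* ρ            ≡⟨ cong (ℚ._* ρ) (ℚℕ-* 2 m) ⟩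
    ℚℕ 2 ℚ.* ℚℕ m ℚ.* ρ         ≡⟨ solve 3 (λ a b c → a :* b :* c := b :* (c :* a)) refl (ℚℕ 2) (ℚℕ m) ρ ⟩
    ℚℕ m ℚ.* (ρ ℚ.* ℚℕ 2)       ≡⟨ cong (ℚℕ m ℚ.*_) (recip-*-ℚℕ 1 dm) ⟩
    ℚℕ m ℚ.* recip D            ∎))
    where
    open ≡-Reasoning
    open ℚ-Solver.+-*-Solver

  H≡lin : ∀ x → H p a u b D x ≡ lin (A x) (x * U)
  H≡lin zero    = sym (trans (cong₂ ℚ._+_ (trans (cong (ℚ._* ρ) ℚℕ-0) (QP.*-zeroˡ ρ))
                                          (trans (cong (κ ℚ.*_) ℚℕ-0) (QP.*-zeroʳ κ)))
                             (QP.+-identityˡ 0ℚ))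
  H≡lin (suc x) = begin
    H p a u b D (suc x)
      ≡⟨ cong (λ xs → foldr ℚ._+_ 0ℚ (map slope xs)) (LP.upTo-∷ʳ x) ⟨
    foldr ℚ._+_ 0ℚ (map slope (upTo x ∷ʳ x))
      ≡⟨ cong (foldr ℚ._+_ 0ℚ) (LP.map-++ slope (upTo x) [ x ]) ⟩
    foldr ℚ._+_ 0ℚ (map slope (upTo x) ++ [ slope x ])
      ≡⟨ LP.foldr-++ ℚ._+_ 0ℚ (map slope (upTo x)) [ slope x ] ⟩
    foldr ℚ._+_ (slope x ℚ.+ 0ℚ) (map slope (upTo x))
      ≡⟨ foldr-+-init (map slope (upTo x)) (slope x ℚ.+ 0ℚ) ⟩
    H p a u b D x ℚ.+ (slope x ℚ.+ 0ℚ)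
      ≡⟨ cong₂ ℚ._+_ (H≡lin x) (trans (QP.+-identityʳ (slope x)) (slope≡lin x)) ⟩
    lin (A x) (x * U) ℚ.+ lin (2 * x) U
      ≡⟨ lin-+ (A x) (2 * x) (x * U) U ⟨
    lin (A x + 2 * x) (x * U + U)
      ≡⟨ cong₂ lin (m[m∸1]+2m x) (NP.+-comm (x * U) U) ⟩
    lin (A (suc x)) (suc x * U) ∎
    where open ≡-Reasoning

  P-D*≡H : Cancellable (+ p) → ∀ n → P p a u b e D einv (D * n) ≡ H p a u b D (D * n)
  P-D*≡H cp n = trans (cong (lin (A (D * n))) (B-D* cp n)) (sym (H≡lin (D * n)))

  Edm+Edm≤p∸1 : E * (2 * D ∸ 1) < p → E * dm + E * dm ≤ p ∸ 1
  Edm+Edm≤p∸1 E[2D∸1]<p = <⇒≤∸1 (NP.≤-<-trans Edm+Edm≤ E[2D∸1]<p)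
    where
    Edm+Edm≤ : E * dm + E * dm ≤ E * (2 * D ∸ 1)
    Edm+Edm≤ = NP.≤-trans (NP.≤-reflexive (sym (NP.*-distribˡ-+ E dm dm)))
      (NP.*-monoʳ-≤ E (NP.+-monoʳ-≤ dm (NP.≤-trans (NP.n≤1+n dm) (NP.≤-reflexive (sym (NP.+-identityʳ D))))))

  module Convexity (b≥1 : 1 ≤ b) (p∸1≥1 : 1 ≤ p ∸ 1) (2Edm≤p∸1 : E * dm + E * dm ≤ p ∸ 1) where

    term-convex : ∀ k n → term k (suc n) + term k (suc n) ≤ (term k (2 + n) + term k n) + (p ∸ 1)
    term-convex k n = begin
      (suc n * x + E * c₁) + (suc n * x + E * c₁)
        ≡⟨ solve 3 (λ n x y → ((con 1 :+ n) :* x :+ y) :+ ((con 1 :+ n) :* x :+ y) := ((con 2 :+ n) :* x :+ n :* x) :+ (y :+ y))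
                 refl n x (E * c₁) ⟩
      ((2 + n) * x + n * x) + (E * c₁ + E * c₁)
        ≤⟨ NP.+-monoʳ-≤ ((2 + n) * x + n * x) Ec₁+Ec₁≤ ⟩
      ((2 + n) * x + n * x) + ((E * c₂ + E * c₀) + (p ∸ 1))
        ≡⟨ solve 5 (λ n x z y q → ((con 2 :+ n) :* x :+ n :* x) :+ ((z :+ y) :+ q) := (((con 2 :+ n) :* x :+ z) :+ (n :* x :+ y)) :+ q)
                 refl n x (E * c₂) (E * c₀) (p ∸ 1) ⟩
      ((2 + n) * x + E * c₂) + (n * x + E * c₀) + (p ∸ 1) ∎
      where
      open NP.≤-Reasoning
      open ℕ-Solver.+-*-Solver
      x = uₖ k
      c₀ = Cₖ k n
      c₁ = Cₖ k (suc n)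
      c₂ = Cₖ k (2 + n)
      Ec₁+Ec₁≤ : E * c₁ + E * c₁ ≤ (E * c₂ + E * c₀) + (p ∸ 1)
      Ec₁+Ec₁≤ = begin
        E * c₁ + E * c₁
          ≤⟨ NP.+-mono-≤ (NP.*-monoʳ-≤ E (Cₖ-suc-≤ k n)) (NP.*-monoʳ-≤ E (Cₖ-≤-suc k (suc n))) ⟩
        E * (c₀ + dm) + E * (c₂ + dm)
          ≡⟨ solve 4 (λ e a b d → e :* (a :+ d) :+ e :* (b :+ d) := (e :* b :+ e :* a) :+ (e :* d :+ e :* d))
                   refl E c₀ c₂ dm ⟩
        (E * c₂ + E * c₀) + (E * dm + E * dm)
          ≤⟨ NP.+-monoʳ-≤ (E * c₂ + E * c₀) 2Edm≤p∸1 ⟩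
        (E * c₂ + E * c₀) + (p ∸ 1) ∎

    c : ℕ
    c = b * (p ∸ 1)

    B-convex : ∀ n → B (suc n) + B (suc n) ≤ (B (2 + n) + B n) + c
    B-convex n = begin
      B (suc n) + B (suc n)
        ≡⟨ Σ1to-+ b (λ k → term k (suc n)) (λ k → term k (suc n)) ⟨
      Σ1to b (λ k → term k (suc n) + term k (suc n))
        ≤⟨ Σ1to-mono b _ _ (λ k → term-convex k n) ⟩
      Σ1to b (λ k → (term k (2 + n) + term k n) + (p ∸ 1))
        ≡⟨ Σ1to-+ b (λ k → term k (2 + n) + term k n) (λ _ → p ∸ 1) ⟩
      Σ1to b (λ k → term k (2 + n) + term k n) + Σ1to b (λ _ → p ∸ 1)
        ≡⟨ cong₂ _+_ (Σ1to-+ b (λ k → term k (2 + n)) (λ k → term k n)) (Σ1to-const b (p ∸ 1)) ⟩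
      (B (2 + n) + B n) + c ∎
      where open NP.≤-Reasoning

    lin-0c≡lin-20 : lin 0 c ≡ lin 2 0
    lin-0c≡lin-20 = trans (lin-0y c) (trans (recip-*-*-ℚℕ dm b≥1 p∸1≥1)
                      (sym (trans (lin-x0 2) (trans (QP.*-comm (ℚℕ 2) ρ) (recip-*-ℚℕ 1 dm)))))

    defect : ℕ → ℕ
    defect n = ((B (2 + n) + B n) + c) ∸ (B (suc n) + B (suc n))

    P-second-difference : ∀ n → P′ (2 + n) ℚ.+ P′ n ≡ (P′ (suc n) ℚ.+ P′ (suc n)) ℚ.+ lin 0 (defect n)
    P-second-difference n = +-cancelʳ (lin 0 c) _ _ (begin
      (lin A₂ B₂ ℚ.+ lin A₀ B₀) ℚ.+ lin 0 c
        ≡⟨ cong (ℚ._+ lin 0 c) (lin-+ A₂ A₀ B₂ B₀) ⟨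
      lin (A₂ + A₀) (B₂ + B₀) ℚ.+ lin 0 c
        ≡⟨ lin-+ (A₂ + A₀) 0 (B₂ + B₀) c ⟨
      lin ((A₂ + A₀) + 0) ((B₂ + B₀) + c)
        ≡⟨ cong₂ lin A≡ (sym (NP.m+[n∸m]≡n (B-convex n))) ⟩
      lin ((A₁ + A₁) + 2) ((B₁ + B₁) + defect n)
        ≡⟨ lin-+ (A₁ + A₁) 2 (B₁ + B₁) (defect n) ⟩
      lin (A₁ + A₁) (B₁ + B₁) ℚ.+ lin 2 (0 + defect n)
        ≡⟨ cong₂ ℚ._+_ (lin-+ A₁ A₁ B₁ B₁) (lin-+ 2 0 0 (defect n)) ⟩
      (lin A₁ B₁ ℚ.+ lin A₁ B₁) ℚ.+ (lin 2 0 ℚ.+ lin 0 (defect n))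
        ≡⟨ cong (λ z → (lin A₁ B₁ ℚ.+ lin A₁ B₁) ℚ.+ (z ℚ.+ lin 0 (defect n))) lin-0c≡lin-20 ⟨
      (lin A₁ B₁ ℚ.+ lin A₁ B₁) ℚ.+ (lin 0 c ℚ.+ lin 0 (defect n))
        ≡⟨ solve 3 (λ X Y Z → X :+ (Y :+ Z) := (X :+ Z) :+ Y)
                 refl (lin A₁ B₁ ℚ.+ lin A₁ B₁) (lin 0 c) (lin 0 (defect n)) ⟩
      ((lin A₁ B₁ ℚ.+ lin A₁ B₁) ℚ.+ lin 0 (defect n)) ℚ.+ lin 0 c ∎)
      where
      open ≡-Reasoning
      open ℚ-Solver.+-*-Solver
      A₀ = A n
      A₁ = A (suc n)
      A₂ = A (2 + n)
      B₀ = B n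
      B₁ = B (suc n)
      B₂ = B (2 + n)
      A≡ : (A₂ + A₀) + 0 ≡ (A₁ + A₁) + 2
      A≡ = begin
        (A₂ + A₀) + 0                  ≡⟨ NP.+-identityʳ _ ⟩
        A (suc (1 + n)) + A₀           ≡⟨ cong (λ m → A (suc m) + A₀) (NP.+-comm 1 n) ⟩
        A (suc n + 1) + A₀             ≡⟨ A-second-difference n 1 ⟩
        (A₁ + A (n + 1)) + 2           ≡⟨ cong (λ m → (A₁ + A m) + 2) (NP.+-comm n 1) ⟩
        (A₁ + A₁) + 2                  ∎

    w-mono : ∀ n → w p a u b e D einv n ℚ.≤ w p a u b e D einv (n + 1)
    w-mono n = subst (λ m → w′ n ℚ.≤ w′ m) (NP.+-comm 1 n) (begin
      w′ n
        ≡⟨ QP.+-identityˡ (w′ n) ⟨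
      0ℚ ℚ.+ w′ n
        ≤⟨ QP.+-monoˡ-≤ (w′ n) 0≤lin ⟩
      lin 0 (defect n) ℚ.+ w′ n
        ≡⟨ difference-from-sums (P′ (2 + n)) (P′ n) (P′ (suc n)) (P′ (suc n)) (lin 0 (defect n))
             (P-second-difference n) ⟨
      w′ (suc n) ∎)
      where
      open QP.≤-Reasoning
      w′ = w p a u b e D einv
      0≤lin : 0ℚ ℚ.≤ lin 0 (defect n)
      0≤lin = subst (0ℚ ℚ.≤_) (sym (lin-0y (defect n)))
                (*-nonneg (recip-nonneg (b * D * (p ∸ 1))) (ℚℕ-nonneg (defect n)))

proposition2p1 :
    (p d e : ℕ) → Prime p → ¬ (p ∣ d) → 1 ≤ e → e < d → Coprime d e →
    (einv : ℤ) → res d (+ e ℤ.* einv) ≡ 1 →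
    (t α : ℤ) →
    -- (1)
    (∀ n → + C p einv d t n
           ≡ + Σ0to n (λ i → R p einv d α i + r einv d t α i) ℤ.- + d ℤ.* + Cbold p einv d t n α)
    ×
    -- (2)
    (∀ n → Cbold p einv d t (n + d) α ≡ d ∸ 1 + Cbold p einv d t n α)
    × (∀ n → C p einv d t (n + d) ≡ C p einv d t n)
    × (∀ a u b → 1 ≤ a → u ≤ p ^ a ∸ 2 → IsLeastPeriod p a u b →
         (∀ n → w p a u b e d einv (n + d) ≡ ℚ.1ℚ ℚ.+ w p a u b e d einv n)
         × (∀ n → P p a u b e d einv (d * n) ≡ H p a u b d (d * n)))
    ×
    -- (3)
    ((d ∸ e) * (2 * d ∸ 1) < p →
       ∀ a u b → 1 ≤ a → u ≤ p ^ a ∸ 2 → IsLeastPeriod p a u b →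
       ∀ n → w p a u b e d einv n ℚ.≤ w p a u b e d einv (n + 1))
proposition2p1 p zero     e _       _   _ ()
proposition2p1 p (suc dm) e p-prime p∤d _ _ _ einv e·einv≡1 t α =
  (λ n → minCost≡ΣRr-D*maxOverflows (suc n)) ,
  (λ n → maxOverflows-+D ce cp (suc n)) ,
  (λ n → minCost-+D cp (suc n)) ,
  (λ a u b _ _ _ → Poly.w-+D a u b cp , Poly.P-D*≡H a u b cp) ,
  (λ p>E[2D∸1] a u b _ _ period →
     Poly.Convexity.w-mono a u b (proj₁ period) p∸1≥1 (Poly.Edm+Edm≤p∸1 a u b p>E[2D∸1]))
  where
  open Residues dm
  open ResidueMatrix p dm einv t
  open Overflows α
  module Poly = Polygon p dm einv e
  cp : Cancellable (+ p)
  cp = prime-cancellable p-prime p∤d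
  ce : Cancellable einv
  ce = cancellable-inverse (+ e) einv e·einv≡1
  p∸1≥1 : 1 ≤ p ∸ 1
  p∸1≥1 = NP.∸-monoˡ-≤ 1 (nonTrivial⇒n>1 p {{prime⇒nonTrivial p-prime}})
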